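{- For $k\ge2$ and $n\in\mathbb{N}$, let $P_k(n)$ be the set of partitions of $n$ with no part divisible by $k$, $p_k(n)=|P_k(n)|$, and for $\mu=(\mu_1,\mu_2,\ldots)\in P_k(n)$ set $p_k(\mu)=\prod_{j}p_k(\mu_j)$ and $\mathrm{maxp}_k(n)=\max\{p_k(\mu):\mu\in P_k(n)\}$. Exponential notation $(j^c)$ denotes $c$ parts equal to $j$; below $a,b\in\mathbb{N}_0$ are arbitrary as long as the listed objects are partitions of $n$, and partitions containing a listed part ($2,3,5,6,7$ where applicable) with positive multiplicity are to be disregarded when $n$ is too small for them. (i) $k=2$: for $n\ge 9$, $n\ne 11$, $\mathrm{maxp}_2(n)$ is attained exactly at the partitions $(9^a,3^b)$ if $n\equiv0\pmod 3$, $(9^a,7,3^b)$ if $n\equiv1\pmod3$, $(9^a,7,7,3^b)$ if $n\equiv 2\pmod 3$; and $\mathrm{maxp}_2(n)=2^{n/3}$, $5\cdot2^{(n-7)/3}$, $5^2\cdot 2^{(n-14)/3}$ respectively. (ii) $k=3$: for $n\ge2$, $n\neq3$, $\mathrm{maxp}_3(n)$ is attained exactly at $(4^a,2^b)$ if $n$ is even and at $(5,4^a,2^b)$ if $n$ is odd; and $\mathrm{maxp}_3(n)=2^{n/2}$ for $n$ even, $5\cdot 2^{(n-5)/2}$ for $n$ odd. (iii) $k=4$: for $n\ge2$, $\mathrm{maxp}_4(n)$ is attained exactly at $(6^a,3^b)$ if $n\equiv0\pmod3$; at $(6^a,3^b,2,2)$, $(7,6^a,3^b)$, $(6^a,5,3^b,2)$,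 $(6^a,5,5,3^b)$ if $n\equiv1\pmod3$; at $(6^a,3^b,2)$, $(6^a,5,3^b)$ if $n\equiv2\pmod3$; and $\mathrm{maxp}_4(n)=3^{n/3}$, $4\cdot3^{(n-4)/3}$, $2\cdot3^{(n-2)/3}$ respectively. (iv) $k=5$: for $n\ge2$, $\mathrm{maxp}_5(n)$ is attained exactly at $(4^{n/4})$ if $n\equiv0\pmod4$; at $(4^{(n-5)/4},3,2)$, $(6,4^{(n-9)/4},3)$ if $n\equiv1\pmod4$; at $(4^{(n-2)/4},2)$, $(6,4^{(n-6)/4})$ if $n\equiv2\pmod4$; at $(4^{(n-3)/4},3)$ if $n\equiv3\pmod4$; and $\mathrm{maxp}_5(n)=5^{n/4}$, $6\cdot5^{(n-5)/4}$, $2\cdot5^{(n-2)/4}$, $3\cdot5^{(n-3)/4}$ respectively. (v) $k=6$: for $n\ge2$, $\mathrm{maxp}_6(n)$ is attained exactly at $(4^{n/4})$ if $n\equiv0\pmod4$; $(5,4^{(n-5)/4})$ if $n\equiv1\pmod4$; $(4^{(n-2)/4},2)$ if $n\equiv2\pmod4$; $(4^{(n-3)/4},3)$ if $n\equiv3\pmod4$; and $\mathrm{maxp}_6(n)=5^{n/4}$, $7\cdot5^{(n-5)/4}$, $2\cdot5^{(n-2)/4}$, $3\cdot5^{(n-3)/4}$ respectively.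
   Context: A partition of $n$ is a weakly decreasing finite sequence of positive integers summing to $n$; it is $k$-regular if no part is divisible by $k$. -}

module Defs where

open import Data.Nat using (ℕ; zero; suc; _+_; _*_; _∸_; _≤_; _<_; _≥_; _≤?_)
open import Data.Nat.Divisibility using (_∣_; _∣?_)
open import Data.List using (List; []; _∷_; [_]; map; concatMap; filter; length; applyUpTo)
open import Data.Nat.ListAction using (sum; product)
open import Data.List.Relation.Unary.All using (All; all?)
open import Data.List.Relation.Unary.Linked using (Linked)
open import Data.Product using (Σ; _×_)
open import Function.Bundles using (_⇔_)
open import Relation.Nullary using (¬_; ¬?)
open import Relation.Binary.PropositionalEquality using (_≡_)

IsPartition : ℕ → List ℕ → Set
IsPartition n μ = Linked _≥_ μ × All (λ j → 0 < j) μ × sum μ ≡ n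

IsRegular : ℕ → List ℕ → Set
IsRegular k μ = All (λ j → ¬ (k ∣ j)) μ

RegPartition : ℕ → ℕ → List ℕ → Set
RegPartition k n μ = IsPartition n μ × IsRegular k μ

-- Explicit enumeration used to define the cardinality p_k(n) = |P_k(n)|.
-- parts f m n : all partitions of n whose parts are all ≤ m (fuel f ≥ n).
parts : ℕ → ℕ → ℕ → List (List ℕ)
parts _ _ zero = [ [] ]
parts zero _ (suc n) = []
parts (suc f) m (suc n) =
  concatMap (λ j → map (j ∷_) (parts f j (suc n ∸ j)))
            (filter (λ j → j ≤? m) (applyUpTo suc (suc n)))

partitions : ℕ → List (List ℕ)
partitions n = parts n n n

regPartitions : ℕ → ℕ → List (List ℕ)
regPartitions k n = filter (λ μ → all? (λ j → ¬? (k ∣? j)) μ) (partitions n)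

p : ℕ → ℕ → ℕ
p k n = length (regPartitions k n)

pμ : ℕ → List ℕ → ℕ
pμ k μ = product (map (p k) μ)

MaxAttainedExactlyAt : ℕ → ℕ → ℕ → (List ℕ → Set) → Set
MaxAttainedExactlyAt k n V Shape =
  (∀ μ → RegPartition k n μ → pμ k μ ≤ V) ×
  Σ (List ℕ) (λ μ → RegPartition k n μ × pμ k μ ≡ V) ×
  (∀ μ → RegPartition k n μ → (pμ k μ ≡ V ⇔ Shape μ))

{-# OPTIONS --safe #-}
-- For each k we fix a modulus e, a base B and, for every residue r mod e, an offset n₀(r)
-- and a coefficient c(r), such that every part j not divisible by k satisfies
--   p_k(j)^e · B^n₀(j mod e) ≤ c(j mod e)^e · B^j,
-- with equality exactly for a few special parts. These bounds are submultiplicative across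
-- residues, so multiplying them over the parts of μ ∈ P_k(n) gives
--   p_k(μ) ≤ c(r) · B^((n - n₀(r))/e),   r = n mod e,
-- with equality iff every part is special and every partial product is tight; sorting out
-- which decreasing lists of special parts are tight yields the extremal shapes.
-- Below an explicit J₀ the part bound is checked by evaluating p_k(j); beyond J₀ it follows
-- from p_k(n) ≤ A ((t + d)/t)^n, proved by induction on the largest part from finitely
-- checked bounds a(m) for the partitions with parts ≤ m.
module Submission where

open import Defs
open import Data.Bool using (true; false; if_then_else_; T)
open import Data.Bool.Properties using (T-≡)
open import Data.Empty using (⊥; ⊥-elim)
open import Data.List using (List; []; _∷_; [_]; _++_; map; filter; concatMap; length; applyUpTo; upTo; replicate)
open import Data.List.Membership.Propositional using (_∈_)
open import Data.List.Properties using (length-++; map-++; map-cong; applyUpTo-∷ʳ; filter-++)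
open import Data.List.Relation.Unary.All using (All; []; _∷_; all?)
import Data.List.Relation.Unary.All as All
open import Data.List.Relation.Unary.All.Properties using (applyUpTo⁻)
open import Data.List.Relation.Unary.Any using (here; there)
open import Data.List.Relation.Unary.Linked using (Linked; []; [-]; _∷_) renaming (tail to linked-tail)
open import Data.Nat
open import Data.List.Membership.DecPropositional _≟_ using (_∈?_)
open import Data.Nat.DivMod
open import Data.Nat.Divisibility using (_∣_; _∣?_; ∣n⇒∣m*n; n∣m⇒m%n≡0; m%n≡0⇒n∣m)
open import Data.Nat.ListAction using (sum)
open import Data.Nat.ListAction.Properties using (sum-++)
open import Data.Nat.Properties
open import Data.Nat.Solver using (module +-*-Solver)
open import Data.Product using (_×_; _,_; proj₁; proj₂; ∃; ∃₂)
open import Data.Sum using (_⊎_; inj₁; inj₂)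
open import Data.Unit using (⊤; tt)
open import Function using (id; _∘_)
open import Function.Bundles using (_⇔_; mk⇔; Equivalence)
open import Function.Properties.Equivalence using () renaming (trans to ⇔-trans)
open import Relation.Nullary using (¬_; ¬?; Dec; yes; no; does; contradiction)
open import Relation.Nullary.Decidable using (True; toWitness; _×-dec_; _⊎-dec_)
open import Relation.Binary.PropositionalEquality hiding ([_])
open +-*-Solver

-- Counting k-regular partitions

module RegularCount (k : ℕ) where

  regular? : (μ : List ℕ) → Dec (IsRegular k μ)
  regular? = all? (λ j → ¬? (k ∣? j))

  countRegular : List (List ℕ) → ℕ
  countRegular X = length (filter regular? X)

  countRegular-++ : ∀ X Y → countRegular (X ++ Y) ≡ countRegular X + countRegular Y
  countRegular-++ X Y = trans (cong length (filter-++ regular? X Y)) (length-++ (filter regular? X))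

  countRegular-concatMap : ∀ (h : ℕ → List (List ℕ)) js →
    countRegular (concatMap h js) ≡ sum (map (countRegular ∘ h) js)
  countRegular-concatMap h [] = refl
  countRegular-concatMap h (j ∷ js) =
    trans (countRegular-++ (h j) (concatMap h js)) (cong (countRegular (h j) +_) (countRegular-concatMap h js))

  countRegular-map-∷ : ∀ j X →
    countRegular (map (j ∷_) X) ≡ (if does (k ∣? j) then 0 else countRegular X)
  countRegular-map-∷ j [] with does (k ∣? j)
  ... | true = refl
  ... | false = refl
  countRegular-map-∷ j (μ ∷ X) with k ∣? j | countRegular-map-∷ j X
  ... | yes _ | ih = ih
  ... | no _ | ih with regular? μ
  ...   | yes _ = cong suc ih
  ...   | no _ = ih

  -- countRegular (parts f m n) without building the partitions, so that it evaluates fast.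
  count : ℕ → ℕ → ℕ → ℕ
  countWithLargest : ℕ → ℕ → ℕ → ℕ
  count _ _ zero = 1
  count zero _ (suc n) = 0
  count (suc f) m (suc n) =
    sum (map (countWithLargest f (suc n)) (filter (_≤? m) (applyUpTo suc (suc n))))
  countWithLargest f n j = if does (k ∣? j) then 0 else count f j (n ∸ j)

  countRegular-parts : ∀ f m n → countRegular (parts f m n) ≡ count f m n
  countRegular-parts _ _ zero = refl
  countRegular-parts zero _ (suc n) = refl
  countRegular-parts (suc f) m (suc n) =
    trans (countRegular-concatMap (λ j → map (j ∷_) (parts f j (suc n ∸ j))) (filter (_≤? m) (applyUpTo suc (suc n))))
          (cong sum (map-cong largest (filter (_≤? m) (applyUpTo suc (suc n)))))
    where
    largest : ∀ j → countRegular (map (j ∷_) (parts f j (suc n ∸ j))) ≡ countWithLargest f (suc n) j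
    largest j with countRegular-map-∷ j (parts f j (suc n ∸ j))
    ... | eq with does (k ∣? j)
    ...   | true = eq
    ...   | false = trans eq (countRegular-parts f j (suc n ∸ j))

  p≡count : ∀ n → p k n ≡ count n n n
  p≡count n = countRegular-parts n n n

-- An exponential upper bound for p_k

restrictedSum : (ℕ → ℕ) → ℕ → ℕ → ℕ
restrictedSum h m zero = 0
restrictedSum h m (suc N) = restrictedSum h m N + (if suc N ≤ᵇ m then h (suc N) else 0)

sum-filter≡restrictedSum : ∀ h m N →
  sum (map h (filter (_≤? m) (applyUpTo suc N))) ≡ restrictedSum h m N
sum-filter≡restrictedSum h m zero = refl
sum-filter≡restrictedSum h m (suc N) = begin
    sum (map h (filter (_≤? m) (applyUpTo suc (suc N))))
  ≡⟨ cong (sum ∘ map h ∘ filter (_≤? m)) (sym (applyUpTo-∷ʳ suc N)) ⟩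
    sum (map h (filter (_≤? m) (applyUpTo suc N ++ [ suc N ])))
  ≡⟨ cong (sum ∘ map h) (filter-++ (_≤? m) (applyUpTo suc N) [ suc N ]) ⟩
    sum (map h (filter (_≤? m) (applyUpTo suc N) ++ filter (_≤? m) [ suc N ]))
  ≡⟨ cong sum (map-++ h (filter (_≤? m) (applyUpTo suc N)) _) ⟩
    sum (map h (filter (_≤? m) (applyUpTo suc N)) ++ map h (filter (_≤? m) [ suc N ]))
  ≡⟨ sum-++ (map h (filter (_≤? m) (applyUpTo suc N))) _ ⟩
    sum (map h (filter (_≤? m) (applyUpTo suc N))) + sum (map h (filter (_≤? m) [ suc N ]))
  ≡⟨ cong₂ _+_ (sum-filter≡restrictedSum h m N) lastTerm ⟩
    restrictedSum h m (suc N) ∎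
  where
  open ≡-Reasoning
  lastTerm : sum (map h (filter (_≤? m) [ suc N ])) ≡ (if suc N ≤ᵇ m then h (suc N) else 0)
  lastTerm with suc N ≤ᵇ m
  ... | true = +-identityʳ _
  ... | false = refl

*-distribˡ-restrictedSum : ∀ c h m N → c * restrictedSum h m N ≡ restrictedSum ((c *_) ∘ h) m N
*-distribˡ-restrictedSum c h m zero = *-zeroʳ c
*-distribˡ-restrictedSum c h m (suc N) =
  trans (*-distribˡ-+ c (restrictedSum h m N) _) (cong₂ _+_ (*-distribˡ-restrictedSum c h m N) lastTerm)
  where
  lastTerm : c * (if suc N ≤ᵇ m then h (suc N) else 0) ≡ (if suc N ≤ᵇ m then c * h (suc N) else 0)
  lastTerm with suc N ≤ᵇ m
  ... | true = refl
  ... | false = *-zeroʳ c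

restrictedSum-mono : ∀ {h h′} m N → (∀ j → j ≤ N → h j ≤ h′ j) → restrictedSum h m N ≤ restrictedSum h′ m N
restrictedSum-mono m zero _ = z≤n
restrictedSum-mono {h} {h′} m (suc N) h≤h′ =
  +-mono-≤ (restrictedSum-mono m N (λ j j≤N → h≤h′ j (m≤n⇒m≤1+n j≤N))) lastTerm
  where
  lastTerm : (if suc N ≤ᵇ m then h (suc N) else 0) ≤ (if suc N ≤ᵇ m then h′ (suc N) else 0)
  lastTerm with suc N ≤ᵇ m
  ... | true = h≤h′ (suc N) ≤-refl
  ... | false = z≤n

module ExponentialBound (k t d : ℕ) (a : ℕ → ℕ) where
  open RegularCount k

  s : ℕ
  s = t + d

  weight : ℕ → ℕ
  weight j = if does (k ∣? j) then 0 else a j * t ^ j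

  -- horner M = Σ_{j=1}^{M} weight j * s ^ (M - j); hornerUpTo m M keeps only the terms with j ≤ m.
  horner : ℕ → ℕ
  horner zero = 0
  horner (suc M) = s * horner M + weight (suc M)

  hornerUpTo : ℕ → ℕ → ℕ
  hornerUpTo m zero = 0
  hornerUpTo m (suc M) = s * hornerUpTo m M + (if suc M ≤ᵇ m then weight (suc M) else 0)

  hornerUpTo≡horner : ∀ m M → M ≤ m → hornerUpTo m M ≡ horner M
  hornerUpTo≡horner m zero _ = refl
  hornerUpTo≡horner m (suc M) M<m rewrite Equivalence.to T-≡ (≤⇒≤ᵇ M<m) =
    cong (λ x → s * x + weight (suc M)) (hornerUpTo≡horner m M (<⇒≤ M<m))

  restrictedSum≡hornerUpTo : ∀ m N M → M ≤ N →
    restrictedSum (λ j → weight j * s ^ (N ∸ j)) m M ≡ hornerUpTo m M * s ^ (N ∸ M)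
  restrictedSum≡hornerUpTo m N zero _ = refl
  restrictedSum≡hornerUpTo m N (suc M) M<N = begin
      restrictedSum term m M + lastTerm term
    ≡⟨ cong (_+ lastTerm term) (restrictedSum≡hornerUpTo m N M (<⇒≤ M<N)) ⟩
      hornerUpTo m M * s ^ (N ∸ M) + lastTerm term
    ≡⟨ cong (λ e → hornerUpTo m M * s ^ e + lastTerm term) (+-∸-assoc 1 M<N) ⟩
      hornerUpTo m M * (s * s ^ (N ∸ suc M)) + lastTerm term
    ≡⟨ factor ⟩
      (s * hornerUpTo m M + lastTerm weight) * s ^ (N ∸ suc M) ∎
    where
    open ≡-Reasoning
    term : ℕ → ℕ
    term j = weight j * s ^ (N ∸ j)
    lastTerm : (ℕ → ℕ) → ℕ
    lastTerm h = if suc M ≤ᵇ m then h (suc M) else 0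
    factor : hornerUpTo m M * (s * s ^ (N ∸ suc M)) + lastTerm term
           ≡ (s * hornerUpTo m M + lastTerm weight) * s ^ (N ∸ suc M)
    factor with suc M ≤ᵇ m
    ... | true = solve 4 (λ x y z w → x :* (y :* z) :+ w :* z := (y :* x :+ w) :* z) refl
                   (hornerUpTo m M) s (s ^ (N ∸ suc M)) (weight (suc M))
    ... | false = solve 3 (λ x y z → x :* (y :* z) :+ con 0 := (y :* x :+ con 0) :* z) refl
                   (hornerUpTo m M) s (s ^ (N ∸ suc M))

  module _ (a-pos : ∀ m → 1 ≤ a m) (a-mono : ∀ m → a m ≤ a (suc m))
           (horner-bound : ∀ M → horner M ≤ a M * s ^ M) where

    a-mono-≤ : ∀ {m m′} → m ≤ m′ → a m ≤ a m′
    a-mono-≤ {m′ = zero} z≤n = ≤-refl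
    a-mono-≤ {m′ = suc m′} m≤1+m′ with m≤n⇒m<n∨m≡n m≤1+m′
    ... | inj₁ m<1+m′ = ≤-trans (a-mono-≤ (s≤s⁻¹ m<1+m′)) (a-mono m′)
    ... | inj₂ refl = ≤-refl

    hornerUpTo-bound : ∀ m M → hornerUpTo m M ≤ a m * s ^ M
    hornerUpTo-bound m zero = z≤n
    hornerUpTo-bound m (suc M) with suc M ≤ᵇ m in eq
    ... | true = begin
        s * hornerUpTo m M + weight (suc M)
      ≡⟨ cong (λ x → s * x + weight (suc M)) (hornerUpTo≡horner m M (<⇒≤ M<m)) ⟩
        horner (suc M)
      ≤⟨ horner-bound (suc M) ⟩
        a (suc M) * s ^ suc M
      ≤⟨ *-monoˡ-≤ (s ^ suc M) (a-mono-≤ M<m) ⟩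
        a m * s ^ suc M ∎
      where
      open ≤-Reasoning
      M<m : suc M ≤ m
      M<m = ≤ᵇ⇒≤ (suc M) m (Equivalence.from T-≡ eq)
    ... | false = begin
        s * hornerUpTo m M + 0
      ≡⟨ +-identityʳ _ ⟩
        s * hornerUpTo m M
      ≤⟨ *-monoʳ-≤ s (hornerUpTo-bound m M) ⟩
        s * (a m * s ^ M)
      ≡⟨ solve 3 (λ x y z → x :* (y :* z) := y :* (x :* z)) refl s (a m) (s ^ M) ⟩
        a m * s ^ suc M ∎
      where open ≤-Reasoning

    count-bound : ∀ f m n → t ^ n * count f m n ≤ a m * s ^ n
    count-bound _ m zero = *-monoˡ-≤ 1 (a-pos m)
    count-bound zero m (suc n) = ≤-trans (≤-reflexive (*-zeroʳ (t ^ suc n))) z≤n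
    count-bound (suc f) m (suc n) = begin
        t ^ N * count (suc f) m N
      ≡⟨ cong (t ^ N *_) (sum-filter≡restrictedSum (countWithLargest f N) m N) ⟩
        t ^ N * restrictedSum (countWithLargest f N) m N
      ≡⟨ *-distribˡ-restrictedSum (t ^ N) (countWithLargest f N) m N ⟩
        restrictedSum (λ j → t ^ N * countWithLargest f N j) m N
      ≤⟨ restrictedSum-mono m N largestPart-bound ⟩
        restrictedSum (λ j → weight j * s ^ (N ∸ j)) m N
      ≡⟨ restrictedSum≡hornerUpTo m N N ≤-refl ⟩
        hornerUpTo m N * s ^ (N ∸ N)
      ≡⟨ cong (λ e → hornerUpTo m N * s ^ e) (n∸n≡0 N) ⟩
        hornerUpTo m N * 1
      ≡⟨ *-identityʳ (hornerUpTo m N) ⟩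
        hornerUpTo m N
      ≤⟨ hornerUpTo-bound m N ⟩
        a m * s ^ N ∎
      where
      open ≤-Reasoning
      N : ℕ
      N = suc n
      largestPart-bound : ∀ j → j ≤ N → t ^ N * countWithLargest f N j ≤ weight j * s ^ (N ∸ j)
      largestPart-bound j j≤N with does (k ∣? j)
      ... | true = ≤-reflexive (*-zeroʳ (t ^ N))
      ... | false = begin
          t ^ N * count f j (N ∸ j)
        ≡⟨ cong (λ e → t ^ e * count f j (N ∸ j)) (sym (m+[n∸m]≡n j≤N)) ⟩
          t ^ (j + (N ∸ j)) * count f j (N ∸ j)
        ≡⟨ cong (_* count f j (N ∸ j)) (^-distribˡ-+-* t j (N ∸ j)) ⟩
          t ^ j * t ^ (N ∸ j) * count f j (N ∸ j)
        ≡⟨ *-assoc (t ^ j) (t ^ (N ∸ j)) _ ⟩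
          t ^ j * (t ^ (N ∸ j) * count f j (N ∸ j))
        ≤⟨ *-monoʳ-≤ (t ^ j) (count-bound f j (N ∸ j)) ⟩
          t ^ j * (a j * s ^ (N ∸ j))
        ≡⟨ solve 3 (λ x y z → x :* (y :* z) := y :* x :* z) refl (t ^ j) (a j) (s ^ (N ∸ j)) ⟩
          a j * t ^ j * s ^ (N ∸ j) ∎

    p-bound : ∀ n → t ^ n * p k n ≤ a n * s ^ n
    p-bound n = subst (λ c → t ^ n * c ≤ a n * s ^ n) (sym (p≡count n)) (count-bound n n n)

  -- Once a is constant, the invariant below propagates because s = t + d; it is the
  -- closed form of a geometric sum, cleared of the denominator d.
  module _ (L A : ℕ) (a-tail : ∀ M → L ≤ M → a M ≡ A)
    (horner-tail : horner L * d + A * t ^ suc L ≤ A * s ^ L * d) where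

    horner-tail-invariant : ∀ o → horner (L + o) * d + A * t ^ suc (L + o) ≤ A * s ^ (L + o) * d
    horner-tail-invariant zero rewrite +-identityʳ L = horner-tail
    horner-tail-invariant (suc o) rewrite +-suc L o = begin
        (s * horner M + weight (suc M)) * d + A * t ^ suc (suc M)
      ≤⟨ +-monoˡ-≤ (A * t ^ suc (suc M)) (*-monoˡ-≤ d (+-monoʳ-≤ (s * horner M) weight≤)) ⟩
        (s * horner M + A * t ^ suc M) * d + A * t ^ suc (suc M)
      ≡⟨ solve 5 (λ t d h A x → ((t :+ d) :* h :+ A :* x) :* d :+ A :* (t :* x)
                              := (t :+ d) :* (h :* d :+ A :* x)) refl t d (horner M) A (t ^ suc M) ⟩
        s * (horner M * d + A * t ^ suc M)
      ≤⟨ *-monoʳ-≤ s (horner-tail-invariant o) ⟩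
        s * (A * s ^ M * d)
      ≡⟨ solve 4 (λ s A x d → s :* (A :* x :* d) := A :* (s :* x) :* d) refl s A (s ^ M) d ⟩
        A * s ^ suc M * d ∎
      where
      open ≤-Reasoning
      M : ℕ
      M = L + o
      weight≤ : weight (suc M) ≤ A * t ^ suc M
      weight≤ with does (k ∣? suc M)
      ... | true = z≤n
      ... | false = ≤-reflexive (cong (_* t ^ suc M) (a-tail (suc M) (m≤n⇒m≤1+n (m≤m+n L o))))

    horner-bound-from-tail : {{_ : NonZero d}} → (∀ M → M < L → horner M ≤ a M * s ^ M) →
                             ∀ M → horner M ≤ a M * s ^ M
    horner-bound-from-tail below M with M <? L
    ... | yes M<L = below M M<L
    ... | no M≮L with m≤n⇒∃[o]m+o≡n (≮⇒≥ M≮L)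
    ...   | o , refl = *-cancelʳ-≤ (horner (L + o)) (a (L + o) * s ^ (L + o)) d (begin
        horner (L + o) * d
      ≤⟨ m≤m+n (horner (L + o) * d) _ ⟩
        horner (L + o) * d + A * t ^ suc (L + o)
      ≤⟨ horner-tail-invariant o ⟩
        A * s ^ (L + o) * d
      ≡⟨ cong (λ x → x * s ^ (L + o) * d) (sym (a-tail (L + o) (m≤m+n L o))) ⟩
        a (L + o) * s ^ (L + o) * d ∎)
      where open ≤-Reasoning

-- The part bounds for large parts

^-distribʳ-* : ∀ m n o → (m * n) ^ o ≡ m ^ o * n ^ o
^-distribʳ-* m n zero = refl
^-distribʳ-* m n (suc o) = trans (cong (m * n *_) (^-distribʳ-* m n o))
  (solve 4 (λ a b c d → a :* b :* (c :* d) := a :* c :* (b :* d)) refl m n (m ^ o) (n ^ o))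

^-comm : ∀ m n o → (m ^ n) ^ o ≡ (m ^ o) ^ n
^-comm m n o = trans (^-*-assoc m n o) (trans (cong (m ^_) (*-comm n o)) (sym (^-*-assoc m o n)))

module EventualBound (k t s A e B : ℕ) {{_ : NonZero s}}
  (p-bound : ∀ n → t ^ n * p k n ≤ A * s ^ n) (growth : s ^ e ≤ B * t ^ e) (D N J₀ : ℕ)
  (base : A ^ e * (s ^ e) ^ J₀ * D < N * B ^ J₀ * (t ^ e) ^ J₀) where

  -- Raising p-bound to the e-th power, p k j ^ e * D < N * B ^ j follows from this,
  -- and growth makes the left side grow no faster than the right.
  scaled-bound : ∀ o → A ^ e * (s ^ e) ^ (J₀ + o) * D < N * B ^ (J₀ + o) * (t ^ e) ^ (J₀ + o)
  scaled-bound zero rewrite +-identityʳ J₀ = base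
  scaled-bound (suc o) rewrite +-suc J₀ o = begin-strict
      A ^ e * (X * X ^ i) * D
    ≡⟨ solve 4 (λ a x y d → a :* (x :* y) :* d := x :* (a :* y :* d)) refl (A ^ e) X (X ^ i) D ⟩
      X * (A ^ e * X ^ i * D)
    <⟨ *-monoʳ-< X {{m^n≢0 s e}} (scaled-bound o) ⟩
      X * (N * B ^ i * Y ^ i)
    ≤⟨ *-monoˡ-≤ (N * B ^ i * Y ^ i) growth ⟩
      B * Y * (N * B ^ i * Y ^ i)
    ≡⟨ solve 5 (λ b y n u v → b :* y :* (n :* u :* v) := n :* (b :* u) :* (y :* v)) refl B Y N (B ^ i) (Y ^ i) ⟩
      N * (B * B ^ i) * (Y * Y ^ i) ∎
    where
    open ≤-Reasoning
    i X Y : ℕ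
    i = J₀ + o
    X = s ^ e
    Y = t ^ e

  eventual-bound : ∀ j → J₀ ≤ j → p k j ^ e * D < N * B ^ j
  eventual-bound j J₀≤j with m≤n⇒∃[o]m+o≡n J₀≤j
  ... | o , refl = *-cancelʳ-< ((t ^ e) ^ j) (p k j ^ e * D) (N * B ^ j) (begin-strict
      p k j ^ e * D * (t ^ e) ^ j
    ≡⟨ cong (p k j ^ e * D *_) (^-comm t e j) ⟩
      p k j ^ e * D * (t ^ j) ^ e
    ≡⟨ solve 3 (λ x d y → x :* d :* y := y :* x :* d) refl (p k j ^ e) D ((t ^ j) ^ e) ⟩
      (t ^ j) ^ e * p k j ^ e * D
    ≡⟨ cong (_* D) (sym (^-distribʳ-* (t ^ j) (p k j) e)) ⟩
      (t ^ j * p k j) ^ e * D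
    ≤⟨ *-monoˡ-≤ D (^-monoˡ-≤ e (p-bound j)) ⟩
      (A * s ^ j) ^ e * D
    ≡⟨ cong (_* D) (^-distribʳ-* A (s ^ j) e) ⟩
      A ^ e * (s ^ j) ^ e * D
    ≡⟨ cong (λ x → A ^ e * x * D) (^-comm s j e) ⟩
      A ^ e * (s ^ e) ^ j * D
    <⟨ scaled-bound o ⟩
      N * B ^ j * (t ^ e) ^ j ∎)
    where open ≤-Reasoning

-- Multiplying the part bounds

^-cancelˡ-≤ : ∀ {m n} e .{{_ : NonZero e}} → m ^ e ≤ n ^ e → m ≤ n
^-cancelˡ-≤ {m} {n} e mᵉ≤nᵉ with m ≤? n
... | yes m≤n = m≤n
... | no m≰n = contradiction mᵉ≤nᵉ (<⇒≱ (^-monoˡ-< e (≰⇒> m≰n)))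

*-≤-≡-cancel : ∀ {u U v V} → u ≤ U → v ≤ V → .{{_ : NonZero U}} → .{{_ : NonZero V}} →
               u * v ≡ U * V → u ≡ U × v ≡ V
*-≤-≡-cancel {u} {U} {v} {V} u≤U v≤V uv≡UV with m≤n⇒m<n∨m≡n u≤U
... | inj₁ u<U = ⊥-elim (<-irrefl uv≡UV (≤-<-trans (*-monoʳ-≤ u v≤V) (*-monoˡ-< V u<U)))
... | inj₂ refl = refl , *-cancelˡ-≡ v V u uv≡UV

∸-multiple : ∀ n n₀ e .{{_ : NonZero e}} → n % e ≡ n₀ % e → n ∸ n₀ ≡ (n / e ∸ n₀ / e) * e
∸-multiple n n₀ e n≡n₀ = begin
    n ∸ n₀
  ≡⟨ cong₂ _∸_ (m≡m%n+[m/n]*n n e) (m≡m%n+[m/n]*n n₀ e) ⟩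
    (n % e + n / e * e) ∸ (n₀ % e + n₀ / e * e)
  ≡⟨ cong (λ x → (x + n / e * e) ∸ (n₀ % e + n₀ / e * e)) n≡n₀ ⟩
    (n₀ % e + n / e * e) ∸ (n₀ % e + n₀ / e * e)
  ≡⟨ [m+n]∸[m+o]≡n∸o (n₀ % e) (n / e * e) (n₀ / e * e) ⟩
    n / e * e ∸ n₀ / e * e
  ≡⟨ *-distribʳ-∸ e (n / e) (n₀ / e) ⟨
    (n / e ∸ n₀ / e) * e ∎
  where open ≡-Reasoning

≡-mod⇒≡+quotient : ∀ {n n₀} e .{{_ : NonZero e}} → n % e ≡ n₀ % e → n₀ ≤ n →
                   n ≡ n₀ + (n ∸ n₀) / e * e
≡-mod⇒≡+quotient {n} {n₀} e n≡n₀ n₀≤n = begin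
    n
  ≡⟨ m+[n∸m]≡n n₀≤n ⟨
    n₀ + (n ∸ n₀)
  ≡⟨ cong (n₀ +_) (∸-multiple n n₀ e n≡n₀) ⟩
    n₀ + (n / e ∸ n₀ / e) * e
  ≡⟨ cong (λ q → n₀ + q * e) (trans (cong (_/ e) (∸-multiple n n₀ e n≡n₀)) (m*n/n≡m (n / e ∸ n₀ / e) e)) ⟨
    n₀ + (n ∸ n₀) / e * e ∎
  where open ≡-Reasoning

≡-mod⇒≤ : ∀ {n m} e .{{_ : NonZero e}} → n % e ≡ m % e → m ∸ e < n → m ≤ n
≡-mod⇒≤ {n} {m} e n≡m m∸e<n with m ≤? n
... | yes m≤n = m≤n
... | no m≰n = contradiction n≤m∸e (<⇒≱ m∸e<n)
  where
  q : ℕ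
  q = m / e ∸ n / e
  m∸n≡ : m ∸ n ≡ q * e
  m∸n≡ = ∸-multiple m n e (sym n≡m)
  instance
    q≢0 : NonZero q
    q≢0 = m*n≢0⇒m≢0 q {{≢-nonZero (subst (_≢ 0) m∸n≡ (m>n⇒m∸n≢0 (≰⇒> m≰n)))}}
  n≤m∸e : n ≤ m ∸ e
  n≤m∸e = subst (_≤ m ∸ e) (m∸[m∸n]≡n (<⇒≤ (≰⇒> m≰n)))
            (∸-monoʳ-≤ m (subst (e ≤_) (sym m∸n≡) (m≤n*m e q)))

linked-replicate : ∀ w {g} → Linked _≥_ (replicate w g)
linked-replicate zero = []
linked-replicate (suc zero) = [-]
linked-replicate (suc (suc w)) = ≤-refl ∷ linked-replicate (suc w)

linked-replicate-++ : ∀ w {g ν} → Linked _≥_ (g ∷ ν) → Linked _≥_ (replicate w g ++ ν)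
linked-replicate-++ zero linked = linked-tail linked
linked-replicate-++ (suc zero) linked = linked
linked-replicate-++ (suc (suc w)) linked = ≤-refl ∷ linked-replicate-++ (suc w) linked

linked-∷-replicate : ∀ w {j g} → g ≤ j → Linked _≥_ (j ∷ replicate w g)
linked-∷-replicate zero _ = [-]
linked-∷-replicate (suc w) g≤j = g≤j ∷ linked-replicate (suc w)

sum-replicate : ∀ w g → sum (replicate w g) ≡ w * g
sum-replicate zero g = refl
sum-replicate (suc w) g = cong (g +_) (sum-replicate w g)

sum-replicate-++ : ∀ w g ν → sum (replicate w g ++ ν) ≡ sum ν + w * g
sum-replicate-++ w g ν =
  trans (sum-++ (replicate w g) ν) (trans (cong (_+ sum ν) (sum-replicate w g)) (+-comm (w * g) (sum ν)))

quotient-replicate : ∀ {n} m a g .{{_ : NonZero g}} → m + sum (replicate a g) ≡ n → (n ∸ m) / g ≡ a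
quotient-replicate m a g refl = begin
  (m + sum (replicate a g) ∸ m) / g ≡⟨ cong (_/ g) (m+n∸m≡n m (sum (replicate a g))) ⟩
  sum (replicate a g) / g           ≡⟨ cong (_/ g) (sum-replicate a g) ⟩
  a * g / g                         ≡⟨ m*n/n≡m a g ⟩
  a                                 ∎
  where open ≡-Reasoning

quotient-replicate-++ : ∀ {n} m a g ν .{{_ : NonZero g}} → m + sum (replicate a g ++ ν) ≡ n →
                        (n ∸ (m + sum ν)) / g ≡ a
quotient-replicate-++ m a g ν refl = begin
  (m + sum (replicate a g ++ ν) ∸ (m + sum ν)) / g ≡⟨ cong (λ x → (m + x ∸ (m + sum ν)) / g) (sum-replicate-++ a g ν) ⟩
  (m + (sum ν + a * g) ∸ (m + sum ν)) / g          ≡⟨ cong (λ x → (x ∸ (m + sum ν)) / g) (+-assoc m (sum ν) (a * g)) ⟨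
  (m + sum ν + a * g ∸ (m + sum ν)) / g            ≡⟨ cong (_/ g) (m+n∸m≡n (m + sum ν) (a * g)) ⟩
  a * g / g                                        ≡⟨ m*n/n≡m a g ⟩
  a                                                ∎
  where open ≡-Reasoning

≤-sum-replicate-++ : ∀ {n} m a g ν → m + sum (replicate a g ++ ν) ≡ n → m + sum ν ≤ n
≤-sum-replicate-++ m a g ν refl = ≤-trans (m≤m+n (m + sum ν) (a * g))
  (≤-reflexive (trans (+-assoc m (sum ν) (a * g)) (cong (m +_) (sym (sum-replicate-++ a g ν)))))

-- Stated with _≤ᵇ_ so that a numeral part exceeding j is an absurd pattern.
HeadAtMost : ℕ → List ℕ → Set
HeadAtMost j [] = ⊤
HeadAtMost j (x ∷ _) = T (x ≤ᵇ j)

headAtMost : ∀ {j μ} → Linked _≥_ (j ∷ μ) → HeadAtMost j μ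
headAtMost [-] = tt
headAtMost (x≤j ∷ _) = ≤⇒≤ᵇ x≤j

-- The instances take D r = B ^ n₀(r) and N r = c(r) ^ e (see Certificate).
module Potential (k e : ℕ) {{e≢0 : NonZero e}} (B : ℕ) {{_ : NonZero B}} (D N : ℕ → ℕ)
  (D-nonZero : ∀ r → r < e → NonZero (D r)) (N-nonZero : ∀ r → r < e → NonZero (N r))
  (D-0 : D 0 ≡ 1) (N-0 : N 0 ≡ 1)
  (submultiplicative : ∀ a b → a < e → b < e →
     D ((a + b) % e) * N a * N b ≤ N ((a + b) % e) * D a * D b)
  (Special : ℕ → Set)
  (part-bound : ∀ j → ¬ k ∣ j → p k j ^ e * D (j % e) < N (j % e) * B ^ j ⊎ Special j)
  (special-part : ∀ j → Special j → p k j ^ e * D (j % e) ≡ N (j % e) * B ^ j)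
  (special-regular : ∀ j → Special j → 0 < j × ¬ k ∣ j) where

  scaledProduct scaledBound : List ℕ → ℕ
  scaledProduct μ = pμ k μ ^ e * D (sum μ % e)
  scaledBound μ = N (sum μ % e) * B ^ sum μ

  TightStep : ℕ → ℕ → Set
  TightStep a b = D ((a + b) % e) * N a * N b ≡ N ((a + b) % e) * D a * D b

  Tight : List ℕ → Set
  Tight [] = ⊤
  Tight (j ∷ μ) = Special j × TightStep (j % e) (sum μ % e) × Tight μ

  0%e≡0 : 0 % e ≡ 0
  0%e≡0 = m<n⇒m%n≡m (>-nonZero⁻¹ e)

  scaledProduct-[] : scaledProduct [] ≡ scaledBound []
  scaledProduct-[] rewrite 0%e≡0 | D-0 | N-0 = trans (*-identityʳ (1 ^ e)) (^-zeroˡ e)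

  part-≤ : ∀ j → ¬ k ∣ j → p k j ^ e * D (j % e) ≤ N (j % e) * B ^ j
  part-≤ j k∤j with part-bound j k∤j
  ... | inj₁ strict = <⇒≤ strict
  ... | inj₂ special = ≤-reflexive (special-part j special)

  module Step (j : ℕ) (μ : List ℕ) where
    S a b c X Y u U : ℕ
    S = sum μ
    a = j % e
    b = S % e
    c = (j + S) % e
    X = p k j ^ e
    Y = pμ k μ ^ e
    u = X * D a
    U = N a * B ^ j

    c≡ : c ≡ (a + b) % e
    c≡ = %-distribˡ-+ j S e

    instance
      Na≢0 : NonZero (N a)
      Na≢0 = N-nonZero a (m%n<n j e)
      Nb≢0 : NonZero (N b)
      Nb≢0 = N-nonZero b (m%n<n S e)
      Nc≢0 : NonZero (N c)
      Nc≢0 = N-nonZero c (m%n<n (j + S) e)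
      NaNb≢0 : NonZero (N a * N b)
      NaNb≢0 = m*n≢0 (N a) (N b)
      Bʲ≢0 : NonZero (B ^ j)
      Bʲ≢0 = m^n≢0 B j
      Bˢ≢0 : NonZero (B ^ S)
      Bˢ≢0 = m^n≢0 B S
      U≢0 : NonZero U
      U≢0 = m*n≢0 (N a) (B ^ j)
      Vμ≢0 : NonZero (scaledBound μ)
      Vμ≢0 = m*n≢0 (N b) (B ^ S)

    submultiplicative-c : D c * N a * N b ≤ N c * D a * D b
    submultiplicative-c rewrite c≡ = submultiplicative a b (m%n<n j e) (m%n<n S e)

    scaledProduct-∷ : scaledProduct (j ∷ μ) * (N a * N b) ≡ X * Y * (D c * N a * N b)
    scaledProduct-∷ = trans (cong (λ z → z * D c * (N a * N b)) (^-distribʳ-* (p k j) (pμ k μ) e))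
      (solve 5 (λ x y d n m → x :* y :* d :* (n :* m) := x :* y :* (d :* n :* m)) refl X Y (D c) (N a) (N b))

    regroup : X * Y * (N c * D a * D b) ≡ N c * (u * scaledProduct μ)
    regroup = solve 5 (λ x y n d d′ → x :* y :* (n :* d :* d′) := n :* (x :* d :* (y :* d′))) refl
      X Y (N c) (D a) (D b)

    scaledBound-∷ : N c * (U * scaledBound μ) ≡ scaledBound (j ∷ μ) * (N a * N b)
    scaledBound-∷ = trans
      (solve 5 (λ n m x m′ y → n :* (m :* x :* (m′ :* y)) := n :* (x :* y) :* (m :* m′)) refl
        (N c) (N a) (B ^ j) (N b) (B ^ S))
      (cong (λ z → N c * z * (N a * N b)) (sym (^-distribˡ-+-* B j S)))

    lower : scaledProduct (j ∷ μ) * (N a * N b) ≤ N c * (u * scaledProduct μ)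
    lower = ≤-trans (≤-reflexive scaledProduct-∷)
      (≤-trans (*-monoʳ-≤ (X * Y) submultiplicative-c) (≤-reflexive regroup))

    upper : u ≤ U → scaledProduct μ ≤ scaledBound μ →
            N c * (u * scaledProduct μ) ≤ scaledBound (j ∷ μ) * (N a * N b)
    upper u≤U μ≤ = ≤-trans (*-monoʳ-≤ (N c) (*-mono-≤ u≤U μ≤)) (≤-reflexive scaledBound-∷)

  scaledProduct≤scaledBound : ∀ μ → IsRegular k μ → scaledProduct μ ≤ scaledBound μ
  scaledProduct≤scaledBound [] _ = ≤-reflexive scaledProduct-[]
  scaledProduct≤scaledBound (j ∷ μ) (k∤j ∷ reg) =
    *-cancelʳ-≤ _ _ (N a * N b) (≤-trans lower (upper (part-≤ j k∤j) (scaledProduct≤scaledBound μ reg)))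
    where open Step j μ

  -- Equality at the two ends of the chain lower, upper forces equality at every step.
  scaledProduct≡scaledBound⇒Tight : ∀ μ → IsRegular k μ → scaledProduct μ ≡ scaledBound μ → Tight μ
  scaledProduct≡scaledBound⇒Tight [] _ _ = tt
  scaledProduct≡scaledBound⇒Tight (j ∷ μ) (k∤j ∷ reg) eq = special , step , scaledProduct≡scaledBound⇒Tight μ reg μ-eq
    where
    open Step j μ
    μ≤ = scaledProduct≤scaledBound μ reg
    middle-eq : N c * (u * scaledProduct μ) ≡ N c * (U * scaledBound μ)
    middle-eq = ≤-antisym (*-monoʳ-≤ (N c) (*-mono-≤ (part-≤ j k∤j) μ≤))
      (≤-trans (≤-reflexive (trans scaledBound-∷ (cong (_* (N a * N b)) (sym eq)))) lower)
    parts-eq : u ≡ U × scaledProduct μ ≡ scaledBound μ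
    parts-eq = *-≤-≡-cancel (part-≤ j k∤j) μ≤ (*-cancelˡ-≡ _ _ (N c) middle-eq)
    μ-eq = proj₂ parts-eq
    special : Special j
    special with part-bound j k∤j
    ... | inj₁ strict = ⊥-elim (<-irrefl (proj₁ parts-eq) strict)
    ... | inj₂ sp = sp
    instance
      XY≢0 : NonZero (X * Y)
      XY≢0 = m*n≢0 X Y {{m*n≢0⇒m≢0 X {{subst NonZero (sym (proj₁ parts-eq)) U≢0}}}}
                       {{m*n≢0⇒m≢0 Y {{subst NonZero (sym μ-eq) Vμ≢0}}}}
    step : TightStep a b
    step = subst (λ z → D z * N a * N b ≡ N z * D a * D b) c≡ (*-cancelˡ-≡ _ _ (X * Y) (begin
        X * Y * (D c * N a * N b)          ≡⟨ sym scaledProduct-∷ ⟩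
        scaledProduct (j ∷ μ) * (N a * N b) ≡⟨ cong (_* (N a * N b)) eq ⟩
        scaledBound (j ∷ μ) * (N a * N b)   ≡⟨ sym scaledBound-∷ ⟩
        N c * (U * scaledBound μ)          ≡⟨ sym middle-eq ⟩
        N c * (u * scaledProduct μ)        ≡⟨ sym regroup ⟩
        X * Y * (N c * D a * D b)          ∎))
      where open ≡-Reasoning

  Tight⇒scaledProduct≡scaledBound : ∀ μ → Tight μ → scaledProduct μ ≡ scaledBound μ
  Tight⇒scaledProduct≡scaledBound [] _ = scaledProduct-[]
  Tight⇒scaledProduct≡scaledBound (j ∷ μ) (special , step , tight) = *-cancelʳ-≡ _ _ (N a * N b) (begin
      scaledProduct (j ∷ μ) * (N a * N b) ≡⟨ scaledProduct-∷ ⟩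
      X * Y * (D c * N a * N b)          ≡⟨ cong (X * Y *_) (subst (λ z → D z * N a * N b ≡ N z * D a * D b) (sym c≡) step) ⟩
      X * Y * (N c * D a * D b)          ≡⟨ regroup ⟩
      N c * (u * scaledProduct μ)        ≡⟨ cong (λ z → N c * z) (cong₂ _*_ (special-part j special) (Tight⇒scaledProduct≡scaledBound μ tight)) ⟩
      N c * (U * scaledBound μ)          ≡⟨ scaledBound-∷ ⟩
      scaledBound (j ∷ μ) * (N a * N b)   ∎)
    where
    open Step j μ
    open ≡-Reasoning

  TightPartition : ℕ → List ℕ → Set
  TightPartition n μ = Tight μ × Linked _≥_ μ × sum μ ≡ n

  Tight⇒regularParts : ∀ μ → Tight μ → All (λ j → 0 < j × ¬ k ∣ j) μ
  Tight⇒regularParts [] _ = []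
  Tight⇒regularParts (j ∷ μ) (special , _ , tight) = special-regular j special ∷ Tight⇒regularParts μ tight

  TightPartition⇒RegPartition : ∀ {n μ} → TightPartition n μ → RegPartition k n μ
  TightPartition⇒RegPartition {μ = μ} (tight , linked , sum≡n) =
    (linked , proj₁ regularParts , sum≡n) , proj₂ regularParts
    where regularParts = All.unzip (Tight⇒regularParts μ tight)

  module _ {n V} (V-eq : V ^ e * D (n % e) ≡ N (n % e) * B ^ n) where
    instance
      Dn≢0 : NonZero (D (n % e))
      Dn≢0 = D-nonZero (n % e) (m%n<n n e)

    scaledProduct-partition : ∀ {μ} → RegPartition k n μ → scaledProduct μ ≡ pμ k μ ^ e * D (n % e)
    scaledProduct-partition ((_ , _ , refl) , _) = refl

    scaledBound-partition : ∀ {μ} → RegPartition k n μ → scaledBound μ ≡ V ^ e * D (n % e)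
    scaledBound-partition ((_ , _ , refl) , _) = sym V-eq

    pμ≤V : ∀ μ → RegPartition k n μ → pμ k μ ≤ V
    pμ≤V μ μ∈P = ^-cancelˡ-≤ e (*-cancelʳ-≤ _ _ (D (n % e)) (begin
        pμ k μ ^ e * D (n % e) ≡⟨ scaledProduct-partition μ∈P ⟨
        scaledProduct μ        ≤⟨ scaledProduct≤scaledBound μ (proj₂ μ∈P) ⟩
        scaledBound μ          ≡⟨ scaledBound-partition μ∈P ⟩
        V ^ e * D (n % e)      ∎))
      where open ≤-Reasoning

    pμ≡V⇔Tight : ∀ μ → RegPartition k n μ → pμ k μ ≡ V ⇔ Tight μ
    pμ≡V⇔Tight μ μ∈P = mk⇔
      (λ pμ≡V → scaledProduct≡scaledBound⇒Tight μ (proj₂ μ∈P) (begin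
        scaledProduct μ       ≡⟨ scaledProduct-partition μ∈P ⟩
        pμ k μ ^ e * D (n % e) ≡⟨ cong (λ x → x ^ e * D (n % e)) pμ≡V ⟩
        V ^ e * D (n % e)     ≡⟨ scaledBound-partition μ∈P ⟨
        scaledBound μ         ∎))
      (λ tight → ≤-antisym (pμ≤V μ μ∈P) (^-cancelˡ-≤ e (≤-reflexive (*-cancelʳ-≡ _ _ (D (n % e)) (begin
        V ^ e * D (n % e)      ≡⟨ scaledBound-partition μ∈P ⟨
        scaledBound μ          ≡⟨ Tight⇒scaledProduct≡scaledBound μ tight ⟨
        scaledProduct μ        ≡⟨ scaledProduct-partition μ∈P ⟩
        pμ k μ ^ e * D (n % e) ∎)))))
      where open ≡-Reasoning

    maxAttainedExactlyAt-Tight : ∀ (Shape : List ℕ → Set) →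
      (∀ μ → RegPartition k n μ → Tight μ ⇔ Shape μ) →
      ∃ (TightPartition n) →
      MaxAttainedExactlyAt k n V Shape
    maxAttainedExactlyAt-Tight Shape Tight⇔Shape (μ , μ-tight) =
      pμ≤V ,
      (μ , μ∈P , Equivalence.from (pμ≡V⇔Tight μ μ∈P) (proj₁ μ-tight)) ,
      λ ν ν∈P → ⇔-trans (pμ≡V⇔Tight ν ν∈P) (Tight⇔Shape ν ν∈P)
      where μ∈P = TightPartition⇒RegPartition μ-tight

  maxAttained : ∀ n {r n₀} c (Shape : List ℕ → Set) → n % e ≡ r → n₀ % e ≡ r → n₀ ≤ n →
    D r ≡ B ^ n₀ → N r ≡ c ^ e →
    (∀ μ → RegPartition k n μ → Tight μ ⇔ Shape μ) →
    (∀ w → ∃ (TightPartition (n₀ + w * e))) →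
    MaxAttainedExactlyAt k n (c * B ^ ((n ∸ n₀) / e)) Shape
  maxAttained n {r} {n₀} c Shape n≡r n₀≡r n₀≤n D-r N-r Tight⇔Shape witness =
    maxAttainedExactlyAt-Tight V-eq Shape Tight⇔Shape (μ , μ-tight)
    where
    w : ℕ
    w = (n ∸ n₀) / e
    n≡ : n ≡ n₀ + w * e
    n≡ = ≡-mod⇒≡+quotient e (trans n≡r (sym n₀≡r)) n₀≤n
    μ = proj₁ (witness w)
    μ-tight : TightPartition n μ
    μ-tight = subst (λ m → TightPartition m μ) (sym n≡) (proj₂ (witness w))
    V-eq : (c * B ^ w) ^ e * D (n % e) ≡ N (n % e) * B ^ n
    V-eq rewrite n≡r | D-r | N-r = begin
        (c * B ^ w) ^ e * B ^ n₀       ≡⟨ cong (_* B ^ n₀) (^-distribʳ-* c (B ^ w) e) ⟩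
        c ^ e * (B ^ w) ^ e * B ^ n₀   ≡⟨ cong (λ x → c ^ e * x * B ^ n₀) (^-*-assoc B w e) ⟩
        c ^ e * B ^ (w * e) * B ^ n₀   ≡⟨ *-assoc (c ^ e) (B ^ (w * e)) (B ^ n₀) ⟩
        c ^ e * (B ^ (w * e) * B ^ n₀) ≡⟨ cong (c ^ e *_) (^-distribˡ-+-* B (w * e) n₀) ⟨
        c ^ e * B ^ (w * e + n₀)       ≡⟨ cong (λ m → c ^ e * B ^ m) (trans (+-comm (w * e) n₀) (sym n≡)) ⟩
        c ^ e * B ^ n                  ∎
      where open ≡-Reasoning

  maxAttained₀ : ∀ n (Shape : List ℕ → Set) → n % e ≡ 0 →
    (∀ μ → RegPartition k n μ → Tight μ ⇔ Shape μ) →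
    (∀ w → ∃ (TightPartition (w * e))) →
    MaxAttainedExactlyAt k n (B ^ (n / e)) Shape
  maxAttained₀ n Shape n≡0 Tight⇔Shape witness =
    subst (λ V → MaxAttainedExactlyAt k n V Shape) (*-identityˡ (B ^ (n / e)))
      (maxAttained n 1 Shape n≡0 0%e≡0 z≤n D-0 (trans N-0 (sym (^-zeroˡ e))) Tight⇔Shape witness)

  module Classification (Extremal : ℕ → List ℕ → Set) (Extremal-[] : Extremal 0 [])
    (extend : ∀ {j r μ} → Special j → TightStep (j % e) r → HeadAtMost j μ →
              Extremal r μ → Extremal ((j % e + r) % e) (j ∷ μ))
    (Extremal⇒Tight : ∀ {r μ} → Extremal r μ → Tight μ) where

    Tight⇒Extremal : ∀ μ → Linked _≥_ μ → Tight μ → Extremal (sum μ % e) μ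
    Tight⇒Extremal [] _ _ = subst (λ r → Extremal r []) (sym 0%e≡0) Extremal-[]
    Tight⇒Extremal (j ∷ μ) linked (special , step , tight) =
      subst (λ r → Extremal r (j ∷ μ)) (sym (%-distribˡ-+ j (sum μ) e))
        (extend special step (headAtMost linked) (Tight⇒Extremal μ (linked-tail linked) tight))

    Tight⇔Extremal : ∀ {n r} → n % e ≡ r → ∀ μ → RegPartition k n μ → Tight μ ⇔ Extremal r μ
    Tight⇔Extremal n≡r μ ((linked , _ , refl) , _) =
      mk⇔ (subst (λ r → Extremal r μ) n≡r ∘ Tight⇒Extremal μ linked) Extremal⇒Tight

  TightStep-0 : ∀ m → TightStep 0 (m % e)
  TightStep-0 m rewrite m%n%n≡m%n m e {{e≢0}} | D-0 | N-0 =
    solve 2 (λ x y → x :* con 1 :* y := y :* con 1 :* x) refl (D (m % e)) (N (m % e))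

  ∣-sum-replicate : ∀ w g → g % e ≡ 0 → e ∣ sum (replicate w g)
  ∣-sum-replicate w g g≡0 = subst (e ∣_) (sym (sum-replicate w g)) (∣n⇒∣m*n w (m%n≡0⇒n∣m g e g≡0))

  residue-replicate : ∀ w g → g % e ≡ 0 → sum (replicate w g) % e ≡ 0
  residue-replicate w g g≡0 = n∣m⇒m%n≡0 _ e (∣-sum-replicate w g g≡0)

  residue-replicate-++ : ∀ w g ν → g % e ≡ 0 → sum (replicate w g ++ ν) % e ≡ sum ν % e
  residue-replicate-++ w g ν g≡0 = trans (cong (_% e) (trans (sum-replicate-++ w g ν) (+-comm (sum ν) (w * g))))
    (%-remove-+ˡ (sum ν) (∣n⇒∣m*n w (m%n≡0⇒n∣m g e g≡0)))

  residue-∷-replicate : ∀ j w g → g % e ≡ 0 → sum (j ∷ replicate w g) % e ≡ j % e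
  residue-∷-replicate j w g g≡0 = %-remove-+ʳ j (∣-sum-replicate w g g≡0)

  tight-∷ : ∀ {j μ r} → Special j → sum μ % e ≡ r → TightStep (j % e) r → Tight μ → Tight (j ∷ μ)
  tight-∷ special refl step tight = special , step , tight

  tight-replicate : ∀ {g} → Special g → g % e ≡ 0 → ∀ w → Tight (replicate w g)
  tight-replicate special g≡0 zero = tt
  tight-replicate {g} special g≡0 (suc w) =
    special , subst (λ a → TightStep a (sum (replicate w g) % e)) (sym g≡0) (TightStep-0 _) ,
    tight-replicate special g≡0 w

  tight-replicate-++ : ∀ {g} → Special g → g % e ≡ 0 → ∀ w {μ} → Tight μ → Tight (replicate w g ++ μ)
  tight-replicate-++ special g≡0 zero tight = tight
  tight-replicate-++ {g} special g≡0 (suc w) {μ} tight =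
    special , subst (λ a → TightStep a (sum (replicate w g ++ μ) % e)) (sym g≡0) (TightStep-0 _) ,
    tight-replicate-++ special g≡0 w tight

-- Certificates checked by evaluation

lookupOr : ℕ → List ℕ → ℕ → ℕ
lookupOr d [] _ = d
lookupOr d (x ∷ xs) zero = x
lookupOr d (x ∷ xs) (suc m) = lookupOr d xs m

lookupOr-beyond : ∀ d xs m → length xs ≤ m → lookupOr d xs m ≡ d
lookupOr-beyond d [] m _ = refl
lookupOr-beyond d (x ∷ xs) (suc m) (s≤s le) = lookupOr-beyond d xs m le

upTo⁻ : ∀ {P : ℕ → Set} n → All P (upTo n) → ∀ {i} → i < n → P i
upTo⁻ = applyUpTo⁻ id

-- Together with t and d, the sequence a certifies p_k(n) ≤ A (s/t)^n, which yields the part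
-- bound for j ≥ J₀; the parts j < J₀ are checked by evaluating count.
module Certificate (k e B : ℕ) {{e≢0 : NonZero e}} {{B≢0 : NonZero B}}
  (offset coeff : ℕ → ℕ) (specials : List ℕ)
  (t d : ℕ) {{d≢0 : NonZero d}} (as : List ℕ) (A J₀ : ℕ) where

  open RegularCount k using (count; p≡count)

  D N : ℕ → ℕ
  D r = B ^ offset r
  N r = coeff r ^ e

  L : ℕ
  L = length as

  a : ℕ → ℕ
  a = lookupOr A as

  open ExponentialBound k t d a

  Admissible : ℕ → Set
  Admissible m = 1 ≤ a m × a m ≤ a (suc m) × a m ≤ A

  module Valid (offset-0 : offset 0 ≡ 0) (coeff-0 : coeff 0 ≡ 1)
    (a-ok : True (all? (λ m → 1 ≤? a m ×-dec a m ≤? a (suc m) ×-dec a m ≤? A) (upTo L)))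
    (A-ok : True (1 ≤? A))
    (horner-ok : True (all? (λ M → horner M ≤? a M * s ^ M) (upTo L)))
    (horner-tail-ok : True (horner L * d + A * t ^ suc L ≤? A * s ^ L * d))
    (growth-ok : True (s ^ e ≤? B * t ^ e))
    (eventual-ok : True (all? (λ r → A ^ e * (s ^ e) ^ J₀ * D r <? N r * B ^ J₀ * (t ^ e) ^ J₀) (upTo e)))
    -- 1 + x ≤? y rather than x <? y, which normalises markedly slower here.
    (small-ok : True (all? (λ j → j ∈? specials ⊎-dec k ∣? j ⊎-dec
                                  1 + count j j j ^ e * D (j % e) ≤? N (j % e) * B ^ j) (upTo J₀)))
    (specials-ok : True (all? (λ j → count j j j ^ e * D (j % e) ≟ N (j % e) * B ^ j) specials))
    (submultiplicative-ok : True (all? (λ a → all? (λ b →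
        D ((a + b) % e) * N a * N b ≤? N ((a + b) % e) * D a * D b) (upTo e)) (upTo e)))
    (coeff-ok : True (all? (λ r → 1 ≤? coeff r) (upTo e)))
    (specials-regular-ok : True (all? (λ j → 0 <? j ×-dec ¬? (k ∣? j)) specials)) where

    a-beyond : ∀ m → L ≤ m → a m ≡ A
    a-beyond = lookupOr-beyond A as

    admissible : ∀ m → Admissible m
    admissible m with m <? L
    ... | yes m<L = upTo⁻ L (toWitness a-ok) m<L
    ... | no m≮L rewrite a-beyond m (≮⇒≥ m≮L) | a-beyond (suc m) (m≤n⇒m≤1+n (≮⇒≥ m≮L)) =
      toWitness A-ok , ≤-refl , ≤-refl

    p-bound-A : ∀ n → t ^ n * p k n ≤ A * s ^ n
    p-bound-A n = ≤-trans
      (p-bound (proj₁ ∘ admissible) (proj₁ ∘ proj₂ ∘ admissible)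
        (horner-bound-from-tail L A a-beyond (toWitness horner-tail-ok) (λ M → upTo⁻ L (toWitness horner-ok))) n)
      (*-monoˡ-≤ (s ^ n) (proj₂ (proj₂ (admissible n))))

    instance
      s≢0 : NonZero s
      s≢0 = >-nonZero (≤-trans (>-nonZero⁻¹ d) (m≤n+m d t))

    eventual-bound : ∀ j → J₀ ≤ j → p k j ^ e * D (j % e) < N (j % e) * B ^ j
    eventual-bound j = EventualBound.eventual-bound k t s A e B p-bound-A (toWitness growth-ok)
      (D (j % e)) (N (j % e)) J₀ (upTo⁻ e (toWitness eventual-ok) (m%n<n j e)) j

    part-bound : ∀ j → ¬ k ∣ j → p k j ^ e * D (j % e) < N (j % e) * B ^ j ⊎ j ∈ specials
    part-bound j k∤j with j <? J₀
    ... | no j≮J₀ = inj₁ (eventual-bound j (≮⇒≥ j≮J₀))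
    ... | yes j<J₀ with upTo⁻ J₀ (toWitness small-ok) j<J₀
    ...   | inj₁ special = inj₂ special
    ...   | inj₂ (inj₁ k∣j) = contradiction k∣j k∤j
    ...   | inj₂ (inj₂ strict) rewrite p≡count j = inj₁ strict

    special-part : ∀ j → j ∈ specials → p k j ^ e * D (j % e) ≡ N (j % e) * B ^ j
    special-part j j∈ rewrite p≡count j = All.lookup (toWitness specials-ok) j∈

    submultiplicative : ∀ a b → a < e → b < e → D ((a + b) % e) * N a * N b ≤ N ((a + b) % e) * D a * D b
    submultiplicative a b a<e b<e = upTo⁻ e (upTo⁻ e (toWitness submultiplicative-ok) a<e) b<e

    D-nonZero : ∀ r → r < e → NonZero (D r)
    D-nonZero r _ = m^n≢0 B (offset r)

    N-nonZero : ∀ r → r < e → NonZero (N r)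
    N-nonZero r r<e = m^n≢0 (coeff r) e {{>-nonZero (upTo⁻ e (toWitness coeff-ok) r<e)}}

    D-0 : D 0 ≡ 1
    D-0 = cong (B ^_) offset-0

    N-0 : N 0 ≡ 1
    N-0 = trans (cong (_^ e) coeff-0) (^-zeroˡ e)

    special-regular : ∀ j → j ∈ specials → 0 < j × ¬ k ∣ j
    special-regular j = All.lookup (toWitness specials-regular-ok)

-- The cases k = 2, …, 6

module Regular₂ where
  offset coeff : ℕ → ℕ
  offset 1 = 7
  offset 2 = 14
  offset _ = 0
  coeff 1 = 5
  coeff 2 = 25
  coeff _ = 1

  specials : List ℕ
  specials = 3 ∷ 7 ∷ 9 ∷ []

  pattern three = here refl
  pattern seven = there (here refl)
  pattern nine = there (there (here refl))

  open Certificate 2 3 2 offset coeff specials 7 1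
    (1 ∷ 1 ∷ 1 ∷ 3 ∷ 3 ∷ 6 ∷ 6 ∷ 10 ∷ 10 ∷ 15 ∷ 15 ∷ 19 ∷ 19 ∷ 23 ∷ 23 ∷ 27 ∷ 27 ∷ 30 ∷ 30 ∷ 33 ∷
     33 ∷ 35 ∷ 35 ∷ 36 ∷ 36 ∷ 38 ∷ 38 ∷ 39 ∷ 39 ∷ 40 ∷ 40 ∷ 40 ∷ 40 ∷ 41 ∷ 41 ∷ 41 ∷ 41 ∷ 42 ∷ 42 ∷ 42 ∷ [])
    43 39
  open Valid refl refl tt tt tt tt tt tt tt tt tt tt tt
  open Potential 2 3 2 D N D-nonZero N-nonZero D-0 N-0 submultiplicative (_∈ specials)
    part-bound special-part special-regular

  Extremal : ℕ → List ℕ → Set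
  Extremal 0 μ = ∃₂ λ a b → μ ≡ replicate a 9 ++ replicate b 3
  Extremal 1 μ = ∃₂ λ a b → μ ≡ replicate a 9 ++ 7 ∷ replicate b 3
  Extremal 2 μ = ∃₂ λ a b → μ ≡ replicate a 9 ++ 7 ∷ 7 ∷ replicate b 3
  Extremal _ _ = ⊥

  extend : ∀ {j r μ} → j ∈ specials → TightStep (j % 3) r → HeadAtMost j μ →
           Extremal r μ → Extremal ((j % 3 + r) % 3) (j ∷ μ)
  extend {r = 0} three _ _ (zero , b , refl) = 0 , suc b , refl
  extend {r = 0} three _ () (suc a , b , refl)
  extend {r = 1} three _ () (zero , b , refl)
  extend {r = 1} three _ () (suc a , b , refl)
  extend {r = 2} three _ () (zero , b , refl)
  extend {r = 2} three _ () (suc a , b , refl)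
  extend {r = 0} seven _ _ (zero , b , refl) = 0 , b , refl
  extend {r = 0} seven _ () (suc a , b , refl)
  extend {r = 1} seven _ _ (zero , b , refl) = 0 , b , refl
  extend {r = 1} seven _ () (suc a , b , refl)
  extend {r = 2} seven () _ _
  extend {r = 0} nine _ _ (a , b , refl) = suc a , b , refl
  extend {r = 1} nine _ _ (a , b , refl) = suc a , b , refl
  extend {r = 2} nine _ _ (a , b , refl) = suc a , b , refl
  extend {r = suc (suc (suc _))} _ _ _ ()

  Extremal⇒Tight : ∀ {r μ} → Extremal r μ → Tight μ
  Extremal⇒Tight {0} (a , b , refl) =
    tight-replicate-++ nine refl a (tight-replicate three refl b)
  Extremal⇒Tight {1} (a , b , refl) =
    tight-replicate-++ nine refl a (tight-∷ seven (residue-replicate b 3 refl) refl (tight-replicate three refl b))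
  Extremal⇒Tight {2} (a , b , refl) = tight-replicate-++ nine refl a
    (tight-∷ seven (residue-∷-replicate 7 b 3 refl) refl
      (tight-∷ seven (residue-replicate b 3 refl) refl (tight-replicate three refl b)))

  open Classification Extremal (0 , 0 , refl) extend Extremal⇒Tight

  witness₀ : ∀ w → ∃ (TightPartition (w * 3))
  witness₀ w = replicate w 3 , Extremal⇒Tight {0} (0 , w , refl) , linked-replicate w , sum-replicate w 3

  witness₁ : ∀ w → ∃ (TightPartition (7 + w * 3))
  witness₁ w = 7 ∷ replicate w 3 , Extremal⇒Tight {1} (0 , w , refl) , linked-∷-replicate w (≤ᵇ⇒≤ 3 7 _) ,
               cong (7 +_) (sum-replicate w 3)

  witness₂ : ∀ w → ∃ (TightPartition (14 + w * 3))
  witness₂ w = 7 ∷ 7 ∷ replicate w 3 , Extremal⇒Tight {2} (0 , w , refl) , ≤-refl ∷ linked-∷-replicate w (≤ᵇ⇒≤ 3 7 _) ,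
               cong (λ m → 7 + (7 + m)) (sum-replicate w 3)

  theorem-i : ∀ n → 9 ≤ n → n ≢ 11 →
    (n % 3 ≡ 0 → MaxAttainedExactlyAt 2 n (2 ^ (n / 3)) (Extremal 0)) ×
    (n % 3 ≡ 1 → MaxAttainedExactlyAt 2 n (5 * 2 ^ ((n ∸ 7) / 3)) (Extremal 1)) ×
    (n % 3 ≡ 2 → MaxAttainedExactlyAt 2 n (5 ^ 2 * 2 ^ ((n ∸ 14) / 3)) (Extremal 2))
  theorem-i n 9≤n n≢11 =
    (λ n≡0 → maxAttained₀ n (Extremal 0) n≡0 (Tight⇔Extremal n≡0) witness₀) ,
    (λ n≡1 → maxAttained n 5 (Extremal 1) n≡1 refl (≤-trans (≤ᵇ⇒≤ 7 9 _) 9≤n) refl refl (Tight⇔Extremal n≡1) witness₁) ,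
    (λ n≡2 → maxAttained n 25 (Extremal 2) n≡2 refl (14≤n n≡2) refl refl (Tight⇔Extremal n≡2) witness₂)
    where
    14≤n : n % 3 ≡ 2 → 14 ≤ n
    14≤n n≡2 = ≡-mod⇒≤ 3 n≡2 (≤∧≢⇒< (≡-mod⇒≤ 3 n≡2 9≤n) (n≢11 ∘ sym))

module Regular₃ where
  offset coeff : ℕ → ℕ
  offset 1 = 5
  offset _ = 0
  coeff 1 = 5
  coeff _ = 1

  specials : List ℕ
  specials = 2 ∷ 4 ∷ 5 ∷ []

  pattern two = here refl
  pattern four = there (here refl)
  pattern five = there (there (here refl))

  open Certificate 3 2 2 offset coeff specials 5 1
    (1 ∷ 1 ∷ 3 ∷ 3 ∷ 6 ∷ 10 ∷ 10 ∷ 14 ∷ 18 ∷ 18 ∷ 22 ∷ 25 ∷ 25 ∷ 28 ∷ 30 ∷ 30 ∷ 32 ∷ 34 ∷ 34 ∷ 35 ∷ [])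
    41 24
  open Valid refl refl tt tt tt tt tt tt tt tt tt tt tt
  open Potential 3 2 2 D N D-nonZero N-nonZero D-0 N-0 submultiplicative (_∈ specials)
    part-bound special-part special-regular

  Extremal : ℕ → List ℕ → Set
  Extremal 0 μ = ∃₂ λ a b → μ ≡ replicate a 4 ++ replicate b 2
  Extremal 1 μ = ∃₂ λ a b → μ ≡ 5 ∷ replicate a 4 ++ replicate b 2
  Extremal _ _ = ⊥

  extend : ∀ {j r μ} → j ∈ specials → TightStep (j % 2) r → HeadAtMost j μ →
           Extremal r μ → Extremal ((j % 2 + r) % 2) (j ∷ μ)
  extend {r = 0} two _ _ (zero , b , refl) = 0 , suc b , refl
  extend {r = 0} two _ () (suc a , b , refl)
  extend {r = 1} two _ () (a , b , refl)
  extend {r = 0} four _ _ (a , b , refl) = suc a , b , refl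
  extend {r = 1} four _ () (a , b , refl)
  extend {r = 0} five _ _ (a , b , refl) = a , b , refl
  extend {r = 1} five () _ _
  extend {r = suc (suc _)} _ _ _ ()

  Extremal⇒Tight : ∀ {r μ} → Extremal r μ → Tight μ
  Extremal⇒Tight {0} (a , b , refl) = tight-replicate-++ four refl a (tight-replicate two refl b)
  Extremal⇒Tight {1} (a , b , refl) =
    tight-∷ five (trans (residue-replicate-++ a 4 (replicate b 2) refl) (residue-replicate b 2 refl)) refl
      (Extremal⇒Tight {0} (a , b , refl))

  open Classification Extremal (0 , 0 , refl) extend Extremal⇒Tight

  witness₀ : ∀ w → ∃ (TightPartition (w * 2))
  witness₀ w = replicate w 2 , Extremal⇒Tight {0} (0 , w , refl) , linked-replicate w , sum-replicate w 2

  witness₁ : ∀ w → ∃ (TightPartition (5 + w * 2))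
  witness₁ w = 5 ∷ replicate w 2 , Extremal⇒Tight {1} (0 , w , refl) , linked-∷-replicate w (≤ᵇ⇒≤ 2 5 _) ,
               cong (5 +_) (sum-replicate w 2)

  theorem-ii : ∀ n → 2 ≤ n → n ≢ 3 →
    (n % 2 ≡ 0 → MaxAttainedExactlyAt 3 n (2 ^ (n / 2)) (Extremal 0)) ×
    (n % 2 ≡ 1 → MaxAttainedExactlyAt 3 n (5 * 2 ^ ((n ∸ 5) / 2)) (Extremal 1))
  theorem-ii n 2≤n n≢3 =
    (λ n≡0 → maxAttained₀ n (Extremal 0) n≡0 (Tight⇔Extremal n≡0) witness₀) ,
    (λ n≡1 → maxAttained n 5 (Extremal 1) n≡1 refl (5≤n n≡1) refl refl (Tight⇔Extremal n≡1) witness₁)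
    where
    5≤n : n % 2 ≡ 1 → 5 ≤ n
    5≤n n≡1 = ≡-mod⇒≤ 2 n≡1 (≤∧≢⇒< (≡-mod⇒≤ 2 n≡1 2≤n) (n≢3 ∘ sym))

module Regular₄ where
  offset coeff : ℕ → ℕ
  offset 1 = 4
  offset 2 = 2
  offset _ = 0
  coeff 1 = 4
  coeff 2 = 2
  coeff _ = 1

  specials : List ℕ
  specials = 2 ∷ 3 ∷ 5 ∷ 6 ∷ 7 ∷ []

  pattern two = here refl
  pattern three = there (here refl)
  pattern five = there (there (here refl))
  pattern six = there (there (there (here refl)))
  pattern seven = there (there (there (there (here refl))))

  open Certificate 4 3 3 offset coeff specials 4 1
    (1 ∷ 1 ∷ 3 ∷ 6 ∷ 6 ∷ 9 ∷ 12 ∷ 16 ∷ 16 ∷ 18 ∷ 20 ∷ 22 ∷ 22 ∷ 23 ∷ 25 ∷ 25 ∷ 25 ∷ 26 ∷ 26 ∷ 27 ∷ [])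
    28 24
  open Valid refl refl tt tt tt tt tt tt tt tt tt tt tt
  open Potential 4 3 3 D N D-nonZero N-nonZero D-0 N-0 submultiplicative (_∈ specials)
    part-bound special-part special-regular

  Extremal : ℕ → List ℕ → Set
  Extremal 0 μ = ∃₂ λ a b → μ ≡ replicate a 6 ++ replicate b 3
  Extremal 1 μ = ∃₂ λ a b →
    (μ ≡ replicate a 6 ++ replicate b 3 ++ 2 ∷ 2 ∷ []) ⊎
    (μ ≡ 7 ∷ replicate a 6 ++ replicate b 3) ⊎
    (μ ≡ replicate a 6 ++ 5 ∷ replicate b 3 ++ 2 ∷ []) ⊎
    (μ ≡ replicate a 6 ++ 5 ∷ 5 ∷ replicate b 3)
  Extremal 2 μ = ∃₂ λ a b →
    (μ ≡ replicate a 6 ++ replicate b 3 ++ 2 ∷ []) ⊎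
    (μ ≡ replicate a 6 ++ 5 ∷ replicate b 3)
  Extremal _ _ = ⊥

  extend : ∀ {j r μ} → j ∈ specials → TightStep (j % 3) r → HeadAtMost j μ →
           Extremal r μ → Extremal ((j % 3 + r) % 3) (j ∷ μ)
  extend {r = 0} two _ _ (zero , zero , refl) = 0 , 0 , inj₁ refl
  extend {r = 0} two _ () (zero , suc b , refl)
  extend {r = 0} two _ () (suc a , b , refl)
  extend {r = 1} two () _ _
  extend {r = 2} two _ _ (zero , zero , inj₁ refl) = 0 , 0 , inj₁ refl
  extend {r = 2} two _ () (zero , suc b , inj₁ refl)
  extend {r = 2} two _ () (suc a , b , inj₁ refl)
  extend {r = 2} two _ () (zero , b , inj₂ refl)
  extend {r = 2} two _ () (suc a , b , inj₂ refl)
  extend {r = 0} three _ _ (zero , b , refl) = 0 , suc b , refl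
  extend {r = 0} three _ () (suc a , b , refl)
  extend {r = 1} three _ _ (zero , b , inj₁ refl) = 0 , suc b , inj₁ refl
  extend {r = 1} three _ () (suc a , b , inj₁ refl)
  extend {r = 1} three _ () (a , b , inj₂ (inj₁ refl))
  extend {r = 1} three _ () (zero , b , inj₂ (inj₂ (inj₁ refl)))
  extend {r = 1} three _ () (suc a , b , inj₂ (inj₂ (inj₁ refl)))
  extend {r = 1} three _ () (zero , b , inj₂ (inj₂ (inj₂ refl)))
  extend {r = 1} three _ () (suc a , b , inj₂ (inj₂ (inj₂ refl)))
  extend {r = 2} three _ _ (zero , b , inj₁ refl) = 0 , suc b , inj₁ refl
  extend {r = 2} three _ () (suc a , b , inj₁ refl)
  extend {r = 2} three _ () (zero , b , inj₂ refl)
  extend {r = 2} three _ () (suc a , b , inj₂ refl)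
  extend {r = 0} five _ _ (zero , b , refl) = 0 , b , inj₂ refl
  extend {r = 0} five _ () (suc a , b , refl)
  extend {r = 1} five () _ _
  extend {r = 2} five _ _ (zero , b , inj₁ refl) = 0 , b , inj₂ (inj₂ (inj₁ refl))
  extend {r = 2} five _ () (suc a , b , inj₁ refl)
  extend {r = 2} five _ _ (zero , b , inj₂ refl) = 0 , b , inj₂ (inj₂ (inj₂ refl))
  extend {r = 2} five _ () (suc a , b , inj₂ refl)
  extend {r = 0} six _ _ (a , b , refl) = suc a , b , refl
  extend {r = 1} six _ _ (a , b , inj₁ refl) = suc a , b , inj₁ refl
  extend {r = 1} six _ () (a , b , inj₂ (inj₁ refl))
  extend {r = 1} six _ _ (a , b , inj₂ (inj₂ (inj₁ refl))) =
    suc a , b , inj₂ (inj₂ (inj₁ refl))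
  extend {r = 1} six _ _ (a , b , inj₂ (inj₂ (inj₂ refl))) =
    suc a , b , inj₂ (inj₂ (inj₂ refl))
  extend {r = 2} six _ _ (a , b , inj₁ refl) = suc a , b , inj₁ refl
  extend {r = 2} six _ _ (a , b , inj₂ refl) = suc a , b , inj₂ refl
  extend {r = 0} seven _ _ (a , b , refl) = a , b , inj₂ (inj₁ refl)
  extend {r = 1} seven () _ _
  extend {r = 2} seven () _ _
  extend {r = suc (suc (suc _))} _ _ _ ()

  Extremal⇒Tight : ∀ {r μ} → Extremal r μ → Tight μ
  Extremal⇒Tight {0} (a , b , refl) = tight-replicate-++ six refl a (tight-replicate three refl b)
  Extremal⇒Tight {1} (a , b , inj₁ refl) =
    tight-replicate-++ six refl a (tight-replicate-++ three refl b
      (tight-∷ two refl refl (tight-∷ two refl refl tt)))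
  Extremal⇒Tight {1} (a , b , inj₂ (inj₁ refl)) =
    tight-∷ seven (trans (residue-replicate-++ a 6 (replicate b 3) refl) (residue-replicate b 3 refl)) refl
      (Extremal⇒Tight {0} (a , b , refl))
  Extremal⇒Tight {1} (a , b , inj₂ (inj₂ (inj₁ refl))) =
    tight-replicate-++ six refl a (tight-∷ five (residue-replicate-++ b 3 (2 ∷ []) refl) refl
      (tight-replicate-++ three refl b (tight-∷ two refl refl tt)))
  Extremal⇒Tight {1} (a , b , inj₂ (inj₂ (inj₂ refl))) =
    tight-replicate-++ six refl a (tight-∷ five (residue-∷-replicate 5 b 3 refl) refl
      (tight-∷ five (residue-replicate b 3 refl) refl (tight-replicate three refl b)))
  Extremal⇒Tight {2} (a , b , inj₁ refl) =
    tight-replicate-++ six refl a (tight-replicate-++ three refl b (tight-∷ two refl refl tt))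
  Extremal⇒Tight {2} (a , b , inj₂ refl) =
    tight-replicate-++ six refl a (tight-∷ five (residue-replicate b 3 refl) refl (tight-replicate three refl b))

  open Classification Extremal (0 , 0 , refl) extend Extremal⇒Tight

  witness₀ : ∀ w → ∃ (TightPartition (w * 3))
  witness₀ w = replicate w 3 , Extremal⇒Tight {0} (0 , w , refl) , linked-replicate w , sum-replicate w 3

  witness₁ : ∀ w → ∃ (TightPartition (4 + w * 3))
  witness₁ w = replicate w 3 ++ 2 ∷ 2 ∷ [] , Extremal⇒Tight {1} (0 , w , inj₁ refl) ,
               linked-replicate-++ w (≤ᵇ⇒≤ 2 3 _ ∷ ≤-refl ∷ [-]) , sum-replicate-++ w 3 (2 ∷ 2 ∷ [])

  witness₂ : ∀ w → ∃ (TightPartition (2 + w * 3))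
  witness₂ w = replicate w 3 ++ 2 ∷ [] , Extremal⇒Tight {2} (0 , w , inj₁ refl) ,
               linked-replicate-++ w (≤ᵇ⇒≤ 2 3 _ ∷ [-]) , sum-replicate-++ w 3 (2 ∷ [])

  theorem-iii : ∀ n → 2 ≤ n →
    (n % 3 ≡ 0 → MaxAttainedExactlyAt 4 n (3 ^ (n / 3)) (Extremal 0)) ×
    (n % 3 ≡ 1 → MaxAttainedExactlyAt 4 n (4 * 3 ^ ((n ∸ 4) / 3)) (Extremal 1)) ×
    (n % 3 ≡ 2 → MaxAttainedExactlyAt 4 n (2 * 3 ^ ((n ∸ 2) / 3)) (Extremal 2))
  theorem-iii n 2≤n =
    (λ n≡0 → maxAttained₀ n (Extremal 0) n≡0 (Tight⇔Extremal n≡0) witness₀) ,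
    (λ n≡1 → maxAttained n 4 (Extremal 1) n≡1 refl (≡-mod⇒≤ 3 n≡1 2≤n) refl refl (Tight⇔Extremal n≡1) witness₁) ,
    (λ n≡2 → maxAttained n 2 (Extremal 2) n≡2 refl 2≤n refl refl (Tight⇔Extremal n≡2) witness₂)

module Regular₅ where
  offset coeff : ℕ → ℕ
  offset 1 = 5
  offset 2 = 2
  offset 3 = 3
  offset _ = 0
  coeff 1 = 6
  coeff 2 = 2
  coeff 3 = 3
  coeff _ = 1

  specials : List ℕ
  specials = 2 ∷ 3 ∷ 4 ∷ 6 ∷ []

  pattern two = here refl
  pattern three = there (here refl)
  pattern four = there (there (here refl))
  pattern six = there (there (there (here refl)))

  open Certificate 5 4 5 offset coeff specials 7 2
    (1 ∷ 1 ∷ 2 ∷ 4 ∷ 7 ∷ 7 ∷ 9 ∷ 11 ∷ 12 ∷ 14 ∷ 14 ∷ 15 ∷ 16 ∷ 16 ∷ 17 ∷ 17 ∷ 17 ∷ 17 ∷ 17 ∷ 18 ∷ [])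
    18 21
  open Valid refl refl tt tt tt tt tt tt tt tt tt tt tt
  open Potential 5 4 5 D N D-nonZero N-nonZero D-0 N-0 submultiplicative (_∈ specials)
    part-bound special-part special-regular

  Extremal : ℕ → List ℕ → Set
  Extremal 0 μ = ∃ λ a → μ ≡ replicate a 4
  Extremal 1 μ = ∃ λ a → (μ ≡ replicate a 4 ++ 3 ∷ 2 ∷ []) ⊎ (μ ≡ 6 ∷ replicate a 4 ++ 3 ∷ [])
  Extremal 2 μ = ∃ λ a → (μ ≡ replicate a 4 ++ 2 ∷ []) ⊎ (μ ≡ 6 ∷ replicate a 4)
  Extremal 3 μ = ∃ λ a → μ ≡ replicate a 4 ++ 3 ∷ []
  Extremal _ _ = ⊥

  extend : ∀ {j r μ} → j ∈ specials → TightStep (j % 4) r → HeadAtMost j μ →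
           Extremal r μ → Extremal ((j % 4 + r) % 4) (j ∷ μ)
  extend {r = 0} two _ _ (zero , refl) = 0 , inj₁ refl
  extend {r = 0} two _ () (suc a , refl)
  extend {r = 1} two () _ _
  extend {r = 2} two () _ _
  extend {r = 3} two _ () (zero , refl)
  extend {r = 3} two _ () (suc a , refl)
  extend {r = 0} three _ _ (zero , refl) = 0 , refl
  extend {r = 0} three _ () (suc a , refl)
  extend {r = 1} three () _ _
  extend {r = 2} three _ _ (zero , inj₁ refl) = 0 , inj₁ refl
  extend {r = 2} three _ () (suc a , inj₁ refl)
  extend {r = 2} three _ () (a , inj₂ refl)
  extend {r = 3} three () _ _
  extend {r = 0} four _ _ (a , refl) = suc a , refl
  extend {r = 1} four _ _ (a , inj₁ refl) = suc a , inj₁ refl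
  extend {r = 1} four _ () (a , inj₂ refl)
  extend {r = 2} four _ _ (a , inj₁ refl) = suc a , inj₁ refl
  extend {r = 2} four _ () (a , inj₂ refl)
  extend {r = 3} four _ _ (a , refl) = suc a , refl
  extend {r = 0} six _ _ (a , refl) = a , inj₂ refl
  extend {r = 1} six () _ _
  extend {r = 2} six () _ _
  extend {r = 3} six _ _ (a , refl) = a , inj₂ refl
  extend {r = suc (suc (suc (suc _)))} _ _ _ ()

  Extremal⇒Tight : ∀ {r μ} → Extremal r μ → Tight μ
  Extremal⇒Tight {0} (a , refl) = tight-replicate four refl a
  Extremal⇒Tight {1} (a , inj₁ refl) = tight-replicate-++ four refl a (tight-∷ three refl refl (tight-∷ two refl refl tt))
  Extremal⇒Tight {1} (a , inj₂ refl) =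
    tight-∷ six (residue-replicate-++ a 4 (3 ∷ []) refl) refl (Extremal⇒Tight {3} (a , refl))
  Extremal⇒Tight {2} (a , inj₁ refl) = tight-replicate-++ four refl a (tight-∷ two refl refl tt)
  Extremal⇒Tight {2} (a , inj₂ refl) = tight-∷ six (residue-replicate a 4 refl) refl (tight-replicate four refl a)
  Extremal⇒Tight {3} (a , refl) = tight-replicate-++ four refl a (tight-∷ three refl refl tt)

  open Classification Extremal (0 , refl) extend Extremal⇒Tight

  Shape : ℕ → ℕ → List ℕ → Set
  Shape 0 n μ = μ ≡ replicate (n / 4) 4
  Shape 1 n μ = (μ ≡ replicate ((n ∸ 5) / 4) 4 ++ 3 ∷ 2 ∷ []) ⊎ (9 ≤ n × μ ≡ 6 ∷ replicate ((n ∸ 9) / 4) 4 ++ 3 ∷ [])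
  Shape 2 n μ = (μ ≡ replicate ((n ∸ 2) / 4) 4 ++ 2 ∷ []) ⊎ (6 ≤ n × μ ≡ 6 ∷ replicate ((n ∸ 6) / 4) 4)
  Shape 3 n μ = μ ≡ replicate ((n ∸ 3) / 4) 4 ++ 3 ∷ []
  Shape _ _ _ = ⊥

  Extremal⇔Shape : ∀ r {n μ} → sum μ ≡ n → Extremal r μ ⇔ Shape r n μ
  Extremal⇔Shape 0 sum≡n = mk⇔
    (λ { (a , refl) → cong (λ q → replicate q 4) (sym (quotient-replicate 0 a 4 sum≡n)) })
    (λ eq → _ , eq)
  Extremal⇔Shape 1 sum≡n = mk⇔
    (λ { (a , inj₁ refl) → inj₁ (cong (λ q → replicate q 4 ++ 3 ∷ 2 ∷ []) (sym (quotient-replicate-++ 0 a 4 (3 ∷ 2 ∷ []) sum≡n)))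
       ; (a , inj₂ refl) → inj₂ (≤-sum-replicate-++ 6 a 4 (3 ∷ []) sum≡n ,
                                 cong (λ q → 6 ∷ replicate q 4 ++ 3 ∷ []) (sym (quotient-replicate-++ 6 a 4 (3 ∷ []) sum≡n))) })
    (λ { (inj₁ eq) → _ , inj₁ eq ; (inj₂ (_ , eq)) → _ , inj₂ eq })
  Extremal⇔Shape 2 sum≡n = mk⇔
    (λ { (a , inj₁ refl) → inj₁ (cong (λ q → replicate q 4 ++ 2 ∷ []) (sym (quotient-replicate-++ 0 a 4 (2 ∷ []) sum≡n)))
       ; (a , inj₂ refl) → inj₂ (subst (6 ≤_) sum≡n (m≤m+n 6 _) ,
                                 cong (λ q → 6 ∷ replicate q 4) (sym (quotient-replicate 6 a 4 sum≡n))) })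
    (λ { (inj₁ eq) → _ , inj₁ eq ; (inj₂ (_ , eq)) → _ , inj₂ eq })
  Extremal⇔Shape 3 sum≡n = mk⇔
    (λ { (a , refl) → cong (λ q → replicate q 4 ++ 3 ∷ []) (sym (quotient-replicate-++ 0 a 4 (3 ∷ []) sum≡n)) })
    (λ eq → _ , eq)
  Extremal⇔Shape (suc (suc (suc (suc _)))) _ = mk⇔ (λ ()) (λ ())

  Tight⇔Shape : ∀ {n r} → n % 4 ≡ r → ∀ μ → RegPartition 5 n μ → Tight μ ⇔ Shape r n μ
  Tight⇔Shape {r = r} n≡r μ μ∈P@((_ , _ , sum≡n) , _) = ⇔-trans (Tight⇔Extremal n≡r μ μ∈P) (Extremal⇔Shape r sum≡n)

  witness₀ : ∀ w → ∃ (TightPartition (w * 4))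
  witness₀ w = replicate w 4 , Extremal⇒Tight {0} (w , refl) , linked-replicate w , sum-replicate w 4

  witness₁ : ∀ w → ∃ (TightPartition (5 + w * 4))
  witness₁ w = replicate w 4 ++ 3 ∷ 2 ∷ [] , Extremal⇒Tight {1} (w , inj₁ refl) ,
               linked-replicate-++ w (≤ᵇ⇒≤ 3 4 _ ∷ ≤ᵇ⇒≤ 2 3 _ ∷ [-]) , sum-replicate-++ w 4 (3 ∷ 2 ∷ [])

  witness₂ : ∀ w → ∃ (TightPartition (2 + w * 4))
  witness₂ w = replicate w 4 ++ 2 ∷ [] , Extremal⇒Tight {2} (w , inj₁ refl) ,
               linked-replicate-++ w (≤ᵇ⇒≤ 2 4 _ ∷ [-]) , sum-replicate-++ w 4 (2 ∷ [])

  witness₃ : ∀ w → ∃ (TightPartition (3 + w * 4))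
  witness₃ w = replicate w 4 ++ 3 ∷ [] , Extremal⇒Tight {3} (w , refl) ,
               linked-replicate-++ w (≤ᵇ⇒≤ 3 4 _ ∷ [-]) , sum-replicate-++ w 4 (3 ∷ [])

  theorem-iv : ∀ n → 2 ≤ n →
    (n % 4 ≡ 0 → MaxAttainedExactlyAt 5 n (5 ^ (n / 4)) (Shape 0 n)) ×
    (n % 4 ≡ 1 → MaxAttainedExactlyAt 5 n (6 * 5 ^ ((n ∸ 5) / 4)) (Shape 1 n)) ×
    (n % 4 ≡ 2 → MaxAttainedExactlyAt 5 n (2 * 5 ^ ((n ∸ 2) / 4)) (Shape 2 n)) ×
    (n % 4 ≡ 3 → MaxAttainedExactlyAt 5 n (3 * 5 ^ ((n ∸ 3) / 4)) (Shape 3 n))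
  theorem-iv n 2≤n =
    (λ n≡0 → maxAttained₀ n (Shape 0 n) n≡0 (Tight⇔Shape n≡0) witness₀) ,
    (λ n≡1 → maxAttained n 6 (Shape 1 n) n≡1 refl (≡-mod⇒≤ 4 n≡1 2≤n) refl refl (Tight⇔Shape n≡1) witness₁) ,
    (λ n≡2 → maxAttained n 2 (Shape 2 n) n≡2 refl 2≤n refl refl (Tight⇔Shape n≡2) witness₂) ,
    (λ n≡3 → maxAttained n 3 (Shape 3 n) n≡3 refl (≡-mod⇒≤ 4 n≡3 (≤-trans (n≤1+n 1) 2≤n)) refl refl (Tight⇔Shape n≡3) witness₃)

module Regular₆ where
  offset coeff : ℕ → ℕ
  offset 1 = 5
  offset 2 = 2
  offset 3 = 3
  offset _ = 0
  coeff 1 = 7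
  coeff 2 = 2
  coeff 3 = 3
  coeff _ = 1

  specials : List ℕ
  specials = 2 ∷ 3 ∷ 4 ∷ 5 ∷ []

  pattern two = here refl
  pattern three = there (here refl)
  pattern four = there (there (here refl))
  pattern five = there (there (there (here refl)))

  open Certificate 6 4 5 offset coeff specials 7 2
    (1 ∷ 1 ∷ 2 ∷ 4 ∷ 7 ∷ 9 ∷ 9 ∷ 11 ∷ 13 ∷ 15 ∷ 16 ∷ 17 ∷ 17 ∷ 18 ∷ 18 ∷ 19 ∷ 19 ∷ 19 ∷ 19 ∷ 19 ∷ [])
    20 21
  open Valid refl refl tt tt tt tt tt tt tt tt tt tt tt
  open Potential 6 4 5 D N D-nonZero N-nonZero D-0 N-0 submultiplicative (_∈ specials)
    part-bound special-part special-regular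

  Extremal : ℕ → List ℕ → Set
  Extremal 0 μ = ∃ λ a → μ ≡ replicate a 4
  Extremal 1 μ = ∃ λ a → μ ≡ 5 ∷ replicate a 4
  Extremal 2 μ = ∃ λ a → μ ≡ replicate a 4 ++ 2 ∷ []
  Extremal 3 μ = ∃ λ a → μ ≡ replicate a 4 ++ 3 ∷ []
  Extremal _ _ = ⊥

  extend : ∀ {j r μ} → j ∈ specials → TightStep (j % 4) r → HeadAtMost j μ →
           Extremal r μ → Extremal ((j % 4 + r) % 4) (j ∷ μ)
  extend {r = 0} two _ _ (zero , refl) = 0 , refl
  extend {r = 0} two _ () (suc a , refl)
  extend {r = 1} two () _ _
  extend {r = 2} two () _ _
  extend {r = 3} two () _ _
  extend {r = 0} three _ _ (zero , refl) = 0 , refl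
  extend {r = 0} three _ () (suc a , refl)
  extend {r = 1} three () _ _
  extend {r = 2} three () _ _
  extend {r = 3} three () _ _
  extend {r = 0} four _ _ (a , refl) = suc a , refl
  extend {r = 1} four _ () (a , refl)
  extend {r = 2} four _ _ (a , refl) = suc a , refl
  extend {r = 3} four _ _ (a , refl) = suc a , refl
  extend {r = 0} five _ _ (a , refl) = a , refl
  extend {r = 1} five () _ _
  extend {r = 2} five () _ _
  extend {r = 3} five () _ _
  extend {r = suc (suc (suc (suc _)))} _ _ _ ()

  Extremal⇒Tight : ∀ {r μ} → Extremal r μ → Tight μ
  Extremal⇒Tight {0} (a , refl) = tight-replicate four refl a
  Extremal⇒Tight {1} (a , refl) = tight-∷ five (residue-replicate a 4 refl) refl (tight-replicate four refl a)
  Extremal⇒Tight {2} (a , refl) = tight-replicate-++ four refl a (tight-∷ two refl refl tt)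
  Extremal⇒Tight {3} (a , refl) = tight-replicate-++ four refl a (tight-∷ three refl refl tt)

  open Classification Extremal (0 , refl) extend Extremal⇒Tight

  Shape : ℕ → ℕ → List ℕ → Set
  Shape 0 n μ = μ ≡ replicate (n / 4) 4
  Shape 1 n μ = μ ≡ 5 ∷ replicate ((n ∸ 5) / 4) 4
  Shape 2 n μ = μ ≡ replicate ((n ∸ 2) / 4) 4 ++ 2 ∷ []
  Shape 3 n μ = μ ≡ replicate ((n ∸ 3) / 4) 4 ++ 3 ∷ []
  Shape _ _ _ = ⊥

  Extremal⇔Shape : ∀ r {n μ} → sum μ ≡ n → Extremal r μ ⇔ Shape r n μ
  Extremal⇔Shape 0 sum≡n = mk⇔
    (λ { (a , refl) → cong (λ q → replicate q 4) (sym (quotient-replicate 0 a 4 sum≡n)) }) (λ eq → _ , eq)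
  Extremal⇔Shape 1 sum≡n = mk⇔
    (λ { (a , refl) → cong (λ q → 5 ∷ replicate q 4) (sym (quotient-replicate 5 a 4 sum≡n)) }) (λ eq → _ , eq)
  Extremal⇔Shape 2 sum≡n = mk⇔
    (λ { (a , refl) → cong (λ q → replicate q 4 ++ 2 ∷ []) (sym (quotient-replicate-++ 0 a 4 (2 ∷ []) sum≡n)) })
    (λ eq → _ , eq)
  Extremal⇔Shape 3 sum≡n = mk⇔
    (λ { (a , refl) → cong (λ q → replicate q 4 ++ 3 ∷ []) (sym (quotient-replicate-++ 0 a 4 (3 ∷ []) sum≡n)) })
    (λ eq → _ , eq)
  Extremal⇔Shape (suc (suc (suc (suc _)))) _ = mk⇔ (λ ()) (λ ())

  Tight⇔Shape : ∀ {n r} → n % 4 ≡ r → ∀ μ → RegPartition 6 n μ → Tight μ ⇔ Shape r n μ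
  Tight⇔Shape {r = r} n≡r μ μ∈P@((_ , _ , sum≡n) , _) = ⇔-trans (Tight⇔Extremal n≡r μ μ∈P) (Extremal⇔Shape r sum≡n)

  witness₀ : ∀ w → ∃ (TightPartition (w * 4))
  witness₀ w = replicate w 4 , Extremal⇒Tight {0} (w , refl) , linked-replicate w , sum-replicate w 4

  witness₁ : ∀ w → ∃ (TightPartition (5 + w * 4))
  witness₁ w = 5 ∷ replicate w 4 , Extremal⇒Tight {1} (w , refl) , linked-∷-replicate w (≤ᵇ⇒≤ 4 5 _) ,
               cong (5 +_) (sum-replicate w 4)

  witness₂ : ∀ w → ∃ (TightPartition (2 + w * 4))
  witness₂ w = replicate w 4 ++ 2 ∷ [] , Extremal⇒Tight {2} (w , refl) ,
               linked-replicate-++ w (≤ᵇ⇒≤ 2 4 _ ∷ [-]) , sum-replicate-++ w 4 (2 ∷ [])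

  witness₃ : ∀ w → ∃ (TightPartition (3 + w * 4))
  witness₃ w = replicate w 4 ++ 3 ∷ [] , Extremal⇒Tight {3} (w , refl) ,
               linked-replicate-++ w (≤ᵇ⇒≤ 3 4 _ ∷ [-]) , sum-replicate-++ w 4 (3 ∷ [])

  theorem-v : ∀ n → 2 ≤ n →
    (n % 4 ≡ 0 → MaxAttainedExactlyAt 6 n (5 ^ (n / 4)) (Shape 0 n)) ×
    (n % 4 ≡ 1 → MaxAttainedExactlyAt 6 n (7 * 5 ^ ((n ∸ 5) / 4)) (Shape 1 n)) ×
    (n % 4 ≡ 2 → MaxAttainedExactlyAt 6 n (2 * 5 ^ ((n ∸ 2) / 4)) (Shape 2 n)) ×
    (n % 4 ≡ 3 → MaxAttainedExactlyAt 6 n (3 * 5 ^ ((n ∸ 3) / 4)) (Shape 3 n))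
  theorem-v n 2≤n =
    (λ n≡0 → maxAttained₀ n (Shape 0 n) n≡0 (Tight⇔Shape n≡0) witness₀) ,
    (λ n≡1 → maxAttained n 7 (Shape 1 n) n≡1 refl (≡-mod⇒≤ 4 n≡1 2≤n) refl refl (Tight⇔Shape n≡1) witness₁) ,
    (λ n≡2 → maxAttained n 2 (Shape 2 n) n≡2 refl 2≤n refl refl (Tight⇔Shape n≡2) witness₂) ,
    (λ n≡3 → maxAttained n 3 (Shape 3 n) n≡3 refl (≡-mod⇒≤ 4 n≡3 (≤-trans (n≤1+n 1) 2≤n)) refl refl (Tight⇔Shape n≡3) witness₃)

theorem3p2 :
  -- (i) k = 2
  (∀ n → 9 ≤ n → n ≢ 11 →
    (n % 3 ≡ 0 → MaxAttainedExactlyAt 2 n (2 ^ (n / 3))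
      (λ μ → ∃₂ λ a b → μ ≡ replicate a 9 ++ replicate b 3)) ×
    (n % 3 ≡ 1 → MaxAttainedExactlyAt 2 n (5 * 2 ^ ((n ∸ 7) / 3))
      (λ μ → ∃₂ λ a b → μ ≡ replicate a 9 ++ 7 ∷ replicate b 3)) ×
    (n % 3 ≡ 2 → MaxAttainedExactlyAt 2 n (5 ^ 2 * 2 ^ ((n ∸ 14) / 3))
      (λ μ → ∃₂ λ a b → μ ≡ replicate a 9 ++ 7 ∷ 7 ∷ replicate b 3))) ×
  -- (ii) k = 3
  (∀ n → 2 ≤ n → n ≢ 3 →
    (n % 2 ≡ 0 → MaxAttainedExactlyAt 3 n (2 ^ (n / 2))
      (λ μ → ∃₂ λ a b → μ ≡ replicate a 4 ++ replicate b 2)) ×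
    (n % 2 ≡ 1 → MaxAttainedExactlyAt 3 n (5 * 2 ^ ((n ∸ 5) / 2))
      (λ μ → ∃₂ λ a b → μ ≡ 5 ∷ replicate a 4 ++ replicate b 2))) ×
  -- (iii) k = 4
  (∀ n → 2 ≤ n →
    (n % 3 ≡ 0 → MaxAttainedExactlyAt 4 n (3 ^ (n / 3))
      (λ μ → ∃₂ λ a b → μ ≡ replicate a 6 ++ replicate b 3)) ×
    (n % 3 ≡ 1 → MaxAttainedExactlyAt 4 n (4 * 3 ^ ((n ∸ 4) / 3))
      (λ μ → ∃₂ λ a b →
          (μ ≡ replicate a 6 ++ replicate b 3 ++ 2 ∷ 2 ∷ []) ⊎
          (μ ≡ 7 ∷ replicate a 6 ++ replicate b 3) ⊎
          (μ ≡ replicate a 6 ++ 5 ∷ replicate b 3 ++ 2 ∷ []) ⊎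
          (μ ≡ replicate a 6 ++ 5 ∷ 5 ∷ replicate b 3))) ×
    (n % 3 ≡ 2 → MaxAttainedExactlyAt 4 n (2 * 3 ^ ((n ∸ 2) / 3))
      (λ μ → ∃₂ λ a b →
          (μ ≡ replicate a 6 ++ replicate b 3 ++ 2 ∷ []) ⊎
          (μ ≡ replicate a 6 ++ 5 ∷ replicate b 3)))) ×
  -- (iv) k = 5
  (∀ n → 2 ≤ n →
    (n % 4 ≡ 0 → MaxAttainedExactlyAt 5 n (5 ^ (n / 4))
      (λ μ → μ ≡ replicate (n / 4) 4)) ×
    (n % 4 ≡ 1 → MaxAttainedExactlyAt 5 n (6 * 5 ^ ((n ∸ 5) / 4))
      (λ μ → (μ ≡ replicate ((n ∸ 5) / 4) 4 ++ 3 ∷ 2 ∷ []) ⊎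
             (9 ≤ n × μ ≡ 6 ∷ replicate ((n ∸ 9) / 4) 4 ++ 3 ∷ []))) ×
    (n % 4 ≡ 2 → MaxAttainedExactlyAt 5 n (2 * 5 ^ ((n ∸ 2) / 4))
      (λ μ → (μ ≡ replicate ((n ∸ 2) / 4) 4 ++ 2 ∷ []) ⊎
             (6 ≤ n × μ ≡ 6 ∷ replicate ((n ∸ 6) / 4) 4))) ×
    (n % 4 ≡ 3 → MaxAttainedExactlyAt 5 n (3 * 5 ^ ((n ∸ 3) / 4))
      (λ μ → μ ≡ replicate ((n ∸ 3) / 4) 4 ++ 3 ∷ []))) ×
  -- (v) k = 6
  (∀ n → 2 ≤ n →
    (n % 4 ≡ 0 → MaxAttainedExactlyAt 6 n (5 ^ (n / 4))
      (λ μ → μ ≡ replicate (n / 4) 4)) ×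
    (n % 4 ≡ 1 → MaxAttainedExactlyAt 6 n (7 * 5 ^ ((n ∸ 5) / 4))
      (λ μ → μ ≡ 5 ∷ replicate ((n ∸ 5) / 4) 4)) ×
    (n % 4 ≡ 2 → MaxAttainedExactlyAt 6 n (2 * 5 ^ ((n ∸ 2) / 4))
      (λ μ → μ ≡ replicate ((n ∸ 2) / 4) 4 ++ 2 ∷ [])) ×
    (n % 4 ≡ 3 → MaxAttainedExactlyAt 6 n (3 * 5 ^ ((n ∸ 3) / 4))
      (λ μ → μ ≡ replicate ((n ∸ 3) / 4) 4 ++ 3 ∷ [])))
theorem3p2 = Regular₂.theorem-i , Regular₃.theorem-ii , Regular₄.theorem-iii , Regular₅.theorem-iv , Regular₆.theorem-v
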